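{- For a pattern $p$, let $F_p(x,y)=\sum_{n\geq 0}\sum_{k\geq 0} a_{n,k}x^ny^k$, where $a_{n,k}$ is the number of paths in $\mathcal{D}_n^{h,\geq}$ containing exactly $k$ occurrences of $p$. Then $$F_{UD}(x,y)=\frac{x^2-x^2y-xy+1-\sqrt{ -4x^2+(x^2(y-1)+xy-1)^2}}{2x^2},$$ $$F_{UU}(x,y)=F_{DD}(x,y)=\frac{x^2y^2-x^2y-x+1-\sqrt{ -4x^2y^2+(x^2y(y-1)-x+1)^2}}{2x^2y^2},$$ $$F_{DU}(x,y)=\frac{x^2y-x^2-xy+1-\sqrt{ -4x^2+(x^2(y-1)+xy-1)^2}}{2x^2y}.$$
   Context: Dyck paths are lattice paths with steps $U=(1,1)$, $D=(1,-1)$ from $(0,0)$ to $(2n,0)$ never going below the $x$-axis ($n$ is the semilength). Every nonempty Dyck path $P$ has a unique first return decomposition $P=U\alpha D\beta$ with $\alpha,\beta$ Dyck paths. Let $h(P)$ denote the maximal height of a Dyck path. The set $\mathcal{D}^{h,\geq}$ is defined recursively: it contains the empty path, and a nonempty Dyck path $P=U\alpha D\beta$ belongs to $\mathcal{D}^{h,\geq}$ iff $\alpha,\beta\in\mathcal{D}^{h,\geq}$ and $h(U\alpha D)\geq h(\beta)$. $\mathcal{D}_n^{h,\geq}$ is the set of its elements of semilength $n$. An occurrence of a pattern (a word in $U,D$) in a path is an occurrence as a sequence of consecutive steps. -}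

module Defs where

open import Data.Bool using (Bool; true; false; _∧_; if_then_else_)
open import Data.Nat as ℕ using (ℕ; zero; suc; _⊔_; _∸_; _≡ᵇ_; _≤ᵇ_)
open import Data.Integer as ℤ using (ℤ; +_; _+_; _*_; _-_; -_)
open import Data.List using (List; []; _∷_; _++_; concatMap; filter; length)
open import Relation.Nullary.Decidable using (yes; no)
open import Relation.Binary.PropositionalEquality using (_≡_)

data Step : Set where
  U D : Step

Word : Set
Word = List Step

_==ₛ_ : Step → Step → Bool
U ==ₛ U = true
D ==ₛ D = true
_ ==ₛ _ = false

isPrefix : Word → Word → Bool
isPrefix [] _ = true
isPrefix (_ ∷ _) [] = false
isPrefix (a ∷ p) (b ∷ w) = (a ==ₛ b) ∧ isPrefix p w

occ : Word → Word → ℕ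
occ p [] = if isPrefix p [] then 1 else 0
occ p (s ∷ w) = (if isPrefix p (s ∷ w) then 1 else 0) ℕ.+ occ p w

-- Dyck paths, represented through their (unique) first return
-- decomposition:  ε  is the empty path,  node α β  is  U α D β.

data Dyck : Set where
  ε    : Dyck
  node : Dyck → Dyck → Dyck

word : Dyck → Word
word ε = []
word (node α β) = U ∷ word α ++ D ∷ word β

semilength : Dyck → ℕ
semilength ε = 0
semilength (node α β) = suc (semilength α ℕ.+ semilength β)

height : Dyck → ℕ
height ε = 0
height (node α β) = suc (height α) ⊔ height β

-- membership in D^{h,≥}:  h(U α D) = 1 + h(α) ≥ h(β)
inDh≥ : Dyck → Bool
inDh≥ ε = true
inDh≥ (node α β) = inDh≥ α ∧ inDh≥ β ∧ (height β ≤ᵇ suc (height α))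

-- all Dyck paths of semilength ≤ n (each exactly once)
upTo : ℕ → List Dyck
upTo zero = ε ∷ []
upTo (suc n) =
  ε ∷ concatMap (λ α → concatMap (λ β →
         if semilength α ℕ.+ semilength β ≤ᵇ n then node α β ∷ [] else [])
       (upTo n)) (upTo n)

dyck : ℕ → List Dyck
dyck n = filter (λ P → semilength P ℕ.≟ n) (upTo n)

count : Word → ℕ → ℕ → ℕ
count p n k =
  length (filter (λ P → Data.Bool._≟_ (inDh≥ P ∧ (occ p (word P) ≡ᵇ k)) true) (dyck n))
  where import Data.Bool

-- Formal power series in two variables x, y over ℤ:
-- f n k is the coefficient of x^n y^k.

PS : Set
PS = ℕ → ℕ → ℤ

F : Word → PS
F p n k = + count p n k

Σ≤ : ℕ → (ℕ → ℤ) → ℤ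
Σ≤ zero f = f 0
Σ≤ (suc n) f = Σ≤ n f + f (suc n)

_⊕_ : PS → PS → PS
(f ⊕ g) n k = f n k + g n k

_⊖_ : PS → PS → PS
(f ⊖ g) n k = f n k - g n k

⊝_ : PS → PS
(⊝ f) n k = - f n k

_⊗_ : PS → PS → PS
(f ⊗ g) n k = Σ≤ n (λ i → Σ≤ k (λ j → f i j * g (n ∸ i) (k ∸ j)))

infixl 6 _⊕_ _⊖_
infixl 7 _⊗_
infix 8 ⊝_

const : ℤ → PS
const c zero zero = c
const c _ _ = + 0

X Y : PS
X n k = if (n ≡ᵇ 1) ∧ (k ≡ᵇ 0) then + 1 else + 0
Y n k = if (n ≡ᵇ 0) ∧ (k ≡ᵇ 1) then + 1 else + 0

_≈_ : PS → PS → Set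
f ≈ g = ∀ n k → f n k ≡ g n k
infix 4 _≈_

pUD pUU pDD pDU : Word
pUD = U ∷ D ∷ []
pUU = U ∷ U ∷ []
pDD = D ∷ D ∷ []
pDU = D ∷ U ∷ []

-- For a series B with constant term 1, √B denotes the
-- unique power series S with constant term 1 and S ⊗ S ≈ B.  An identity
-- F = (A - √B) / (2 G) (with A having constant term 1) is thus equivalent to
--   (A - 2 G F) ⊗ (A - 2 G F) ≈ B,
-- since A - 2 G F then has constant term 1 and squares to B.

IsSqrtOf : PS → PS → Set
IsSqrtOf S B = (S 0 0 ≡ + 1) × (S ⊗ S ≈ B)
  where open import Data.Product using (_×_)

two : PS
two = const (+ 2)
one : PS
one = const (+ 1)

A-UD B-UD : PS
A-UD = X ⊗ X ⊖ X ⊗ X ⊗ Y ⊖ X ⊗ Y ⊕ one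
B-UD = ⊝ (const (+ 4) ⊗ X ⊗ X)
       ⊕ (X ⊗ X ⊗ (Y ⊖ one) ⊕ X ⊗ Y ⊖ one) ⊗ (X ⊗ X ⊗ (Y ⊖ one) ⊕ X ⊗ Y ⊖ one)

A-UU B-UU : PS
A-UU = X ⊗ X ⊗ Y ⊗ Y ⊖ X ⊗ X ⊗ Y ⊖ X ⊕ one
B-UU = ⊝ (const (+ 4) ⊗ X ⊗ X ⊗ Y ⊗ Y)
       ⊕ (X ⊗ X ⊗ Y ⊗ (Y ⊖ one) ⊖ X ⊕ one) ⊗ (X ⊗ X ⊗ Y ⊗ (Y ⊖ one) ⊖ X ⊕ one)

-- DU  (same discriminant as UD)
A-DU : PS
A-DU = X ⊗ X ⊗ Y ⊖ X ⊗ X ⊖ X ⊗ Y ⊕ one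

module Submission where

-- For a pattern p of length two, let Eₕ and Aₕ be the generating functions (x marking semilength, y
-- occurrences of p) of the paths of D^{h,≥} of height at most h, resp. exactly h.  Occurrences of p are
-- additive along the first return decomposition P = UαDβ, up to a correction depending only on whether α
-- and β are empty, and UαDβ lies in D^{h,≥} with height h + 1 exactly when α ∈ D^{h,≥} has height h and
-- β ∈ D^{h,≥} has height at most h + 1.  So Eₕ₊₁ = Eₕ + Aₕ₊₁, and Aₕ₊₁ = x Aₕ Eₕ₊₁ up to these corrections.
-- By induction on h this gives Eₕ₊₂ (A − c Eₕ) = 1 (c = x² for UD, c = x²y² for UU; for DU it reads
-- (1 + y(Eₕ₊₂ − 1)) (1 − xy − x²y Eₕ) = 1).  As Eₕ agrees with F_p up to xʰ, F_p satisfies the same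
-- quadratic equation, which is equivalent to the stated formula.  UU and DD occur equally often in every
-- Dyck path.

open import Algebra.Bundles using (CommutativeSemiring; CommutativeRing)
open import Algebra.Structures using (IsCommutativeRing)
open import Data.Bool using (Bool; true; false; if_then_else_)
open import Data.Nat as ℕ using (ℕ; zero; suc; _∸_; _≡ᵇ_; _≤ᵇ_; z≤n; s≤s)
import Data.Nat.Properties as ℕ
open import Data.Product using (_×_; _,_)
open import Function using (_∘_)
open import Relation.Binary.Definitions using (Tri; tri<; tri≈; tri>)
open import Relation.Binary.PropositionalEquality as ≡ using (_≡_; _≢_)
open import Relation.Nullary.Decidable using (yes; no; dec-true; dec-false)

≡ᵇ-true : ∀ {m n} → m ≡ n → (m ≡ᵇ n) ≡ true
≡ᵇ-true = dec-true (_ ℕ.≟ _)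

≡ᵇ-false : ∀ {m n} → m ≢ n → (m ≡ᵇ n) ≡ false
≡ᵇ-false = dec-false (_ ℕ.≟ _)

≤ᵇ-true : ∀ {m n} → m ℕ.≤ n → (m ≤ᵇ n) ≡ true
≤ᵇ-true = dec-true (_ ℕ.≤? _)

≤ᵇ-false : ∀ {m n} → n ℕ.< m → (m ≤ᵇ n) ≡ false
≤ᵇ-false n<m = dec-false (_ ℕ.≤? _) (ℕ.<⇒≱ n<m)

<ᵇ-irrefl : ∀ n → (n ℕ.<ᵇ n) ≡ false
<ᵇ-irrefl n = ≤ᵇ-false (ℕ.n<1+n n)

n<ᵇ1+n : ∀ n → (n ℕ.<ᵇ suc n) ≡ true
n<ᵇ1+n n = ≤ᵇ-true (ℕ.n<1+n n)

module IntervalSums {c ℓ} (S : CommutativeSemiring c ℓ) where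
  open CommutativeSemiring S
  open import Algebra.Properties.CommutativeSemigroup +-commutativeSemigroup using (interchange)
  open import Relation.Binary.Reasoning.Setoid setoid

  sum≤ : ℕ → (ℕ → Carrier) → Carrier
  sum≤ zero    f = f 0
  sum≤ (suc n) f = sum≤ n f + f (suc n)

  sum≤-cong≤ : ∀ n {f g} → (∀ i → i ℕ.≤ n → f i ≈ g i) → sum≤ n f ≈ sum≤ n g
  sum≤-cong≤ zero    f≈g = f≈g 0 z≤n
  sum≤-cong≤ (suc n) f≈g =
    +-cong (sum≤-cong≤ n (λ i i≤n → f≈g i (ℕ.m≤n⇒m≤1+n i≤n))) (f≈g (suc n) ℕ.≤-refl)

  sum≤-cong : ∀ n {f g} → (∀ i → f i ≈ g i) → sum≤ n f ≈ sum≤ n g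
  sum≤-cong n f≈g = sum≤-cong≤ n (λ i _ → f≈g i)

  sum≤-zero : ∀ n {f} → (∀ i → f i ≈ 0#) → sum≤ n f ≈ 0#
  sum≤-zero zero    f≈0 = f≈0 0
  sum≤-zero (suc n) f≈0 = trans (+-cong (sum≤-zero n f≈0) (f≈0 (suc n))) (+-identityˡ 0#)

  sum≤-distrib-+ : ∀ n f g → sum≤ n (λ i → f i + g i) ≈ sum≤ n f + sum≤ n g
  sum≤-distrib-+ zero    f g = refl
  sum≤-distrib-+ (suc n) f g = trans (+-congʳ (sum≤-distrib-+ n f g)) (interchange _ _ _ _)

  *-distribˡ-sum≤ : ∀ n a f → a * sum≤ n f ≈ sum≤ n (λ i → a * f i)
  *-distribˡ-sum≤ zero    a f = refl
  *-distribˡ-sum≤ (suc n) a f = trans (distribˡ _ _ _) (+-congʳ (*-distribˡ-sum≤ n a f))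

  *-distribʳ-sum≤ : ∀ n a f → sum≤ n f * a ≈ sum≤ n (λ i → f i * a)
  *-distribʳ-sum≤ zero    a f = refl
  *-distribʳ-sum≤ (suc n) a f = trans (distribʳ _ _ _) (+-congʳ (*-distribʳ-sum≤ n a f))

  sum≤-unfoldˡ : ∀ n f → sum≤ (suc n) f ≈ f 0 + sum≤ n (f ∘ suc)
  sum≤-unfoldˡ zero    f = refl
  sum≤-unfoldˡ (suc n) f = trans (+-congʳ (sum≤-unfoldˡ n f)) (+-assoc _ _ _)

  sum≤-reverse : ∀ n f → sum≤ n f ≈ sum≤ n (λ i → f (n ∸ i))
  sum≤-reverse zero    f = refl
  sum≤-reverse (suc n) f = begin
    sum≤ n f + f (suc n)                  ≈⟨ +-comm _ _ ⟩
    f (suc n) + sum≤ n f                  ≈⟨ +-congˡ (sum≤-reverse n f) ⟩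
    f (suc n) + sum≤ n (λ i → f (n ∸ i))  ≈⟨ sum≤-unfoldˡ n (λ i → f (suc n ∸ i)) ⟨
    sum≤ (suc n) (λ i → f (suc n ∸ i))    ∎

  sum≤-indicator : ∀ n a (x : ℕ → Carrier) →
    sum≤ n (λ i → if a ≡ᵇ i then x i else 0#) ≈ (if a ≤ᵇ n then x a else 0#)
  sum≤-indicator zero    zero    x = refl
  sum≤-indicator zero    (suc a) x = refl
  sum≤-indicator (suc n) a       x =
    trans (+-congʳ (sum≤-indicator n a x)) (last-term (ℕ.<-cmp a (suc n)))
    where
    last-term : Tri (a ℕ.< suc n) (a ≡ suc n) (suc n ℕ.< a) →
      (if a ≤ᵇ n then x a else 0#) + (if a ≡ᵇ suc n then x (suc n) else 0#)
        ≈ (if a ≤ᵇ suc n then x a else 0#)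
    last-term (tri< a<1+n a≢1+n _)
      rewrite ≤ᵇ-true (ℕ.m<1+n⇒m≤n a<1+n) | ≡ᵇ-false a≢1+n | ≤ᵇ-true (ℕ.<⇒≤ a<1+n) =
      +-identityʳ (x a)
    last-term (tri≈ _ a≡1+n _) rewrite a≡1+n | <ᵇ-irrefl n | ≡ᵇ-true {n} ≡.refl | n<ᵇ1+n n =
      +-identityˡ (x (suc n))
    last-term (tri> _ a≢1+n 1+n<a)
      rewrite ≤ᵇ-false (ℕ.<-trans (ℕ.n<1+n n) 1+n<a) | ≡ᵇ-false a≢1+n | ≤ᵇ-false 1+n<a =
      +-identityˡ 0#

  sum≤-triangle : ∀ n (T : ℕ → ℕ → Carrier) →
    sum≤ n (λ i → sum≤ i (T i)) ≈ sum≤ n (λ a → sum≤ (n ∸ a) (λ b → T (a ℕ.+ b) a))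
  sum≤-triangle zero    T = refl
  sum≤-triangle (suc n) T = begin
    sum≤ n (λ i → sum≤ i (T i)) + sum≤ (suc n) (T (suc n))
      ≈⟨ +-congʳ (sum≤-triangle n T) ⟩
    sum≤ n columns + (sum≤ n (T (suc n)) + T (suc n) (suc n))
      ≈⟨ +-assoc _ _ _ ⟨
    (sum≤ n columns + sum≤ n (T (suc n))) + T (suc n) (suc n)
      ≈⟨ +-congʳ (sum≤-distrib-+ n columns (T (suc n))) ⟨
    sum≤ n (λ a → columns a + T (suc n) a) + T (suc n) (suc n)
      ≈⟨ +-cong (sum≤-cong≤ n extend-column) last-column ⟩
    sum≤ n (λ a → sum≤ (suc n ∸ a) (λ b → T (a ℕ.+ b) a)) + sum≤ (n ∸ n) (λ b → T (suc n ℕ.+ b) (suc n)) ∎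
    where
    columns : ℕ → Carrier
    columns a = sum≤ (n ∸ a) (λ b → T (a ℕ.+ b) a)
    last-column : T (suc n) (suc n) ≈ sum≤ (n ∸ n) (λ b → T (suc n ℕ.+ b) (suc n))
    last-column rewrite ℕ.n∸n≡0 n | ℕ.+-identityʳ n = refl
    extend-column : ∀ a → a ℕ.≤ n → columns a + T (suc n) a ≈ sum≤ (suc n ∸ a) (λ b → T (a ℕ.+ b) a)
    extend-column a a≤n rewrite ℕ.+-∸-assoc 1 a≤n =
      +-congˡ (reflexive (≡.cong (λ m → T m a) (≡.sym a+[1+n∸a]≡1+n)))
      where
      a+[1+n∸a]≡1+n : a ℕ.+ suc (n ∸ a) ≡ suc n
      a+[1+n∸a]≡1+n = ≡.trans (ℕ.+-suc a (n ∸ a)) (≡.cong suc (ℕ.m+[n∸m]≡n a≤n))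

module PowerSeries {c ℓ} (R : CommutativeRing c ℓ) where
  open CommutativeRing R
  open IntervalSums commutativeSemiring public
  import Algebra.Construct.Pointwise as Pointwise
  open import Relation.Binary.Reasoning.Setoid setoid

  Series : Set c
  Series = ℕ → Carrier

  infix 4 _≋_
  _≋_ : Series → Series → Set ℓ
  f ≋ g = ∀ n → f n ≈ g n

  infixl 6 _+ₛ_
  _+ₛ_ : Series → Series → Series
  (f +ₛ g) n = f n + g n

  -ₛ_ : Series → Series
  (-ₛ f) n = - f n

  infixl 7 _*ₛ_
  _*ₛ_ : Series → Series → Series
  (f *ₛ g) n = sum≤ n (λ i → f i * g (n ∸ i))

  constantₛ : Carrier → Series
  constantₛ a zero    = a
  constantₛ a (suc _) = 0#

  shift : Series → Series
  shift f zero    = 0#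
  shift f (suc n) = f n

  0ₛ 1ₛ xₛ : Series
  0ₛ _ = 0#
  1ₛ   = constantₛ 1#
  xₛ   = shift 1ₛ

  *ₛ-comm : ∀ f g → f *ₛ g ≋ g *ₛ f
  *ₛ-comm f g n = begin
    sum≤ n (λ i → f i * g (n ∸ i))                  ≈⟨ sum≤-reverse n _ ⟩
    sum≤ n (λ i → f (n ∸ i) * g (n ∸ (n ∸ i)))      ≈⟨ sum≤-cong≤ n swap ⟩
    sum≤ n (λ i → g i * f (n ∸ i))                  ∎
    where
    swap : ∀ i → i ℕ.≤ n → f (n ∸ i) * g (n ∸ (n ∸ i)) ≈ g i * f (n ∸ i)
    swap i i≤n = trans (*-comm _ _) (*-congʳ (reflexive (≡.cong g (ℕ.m∸[m∸n]≡n i≤n))))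

  *ₛ-cong : ∀ {f f′ g g′} → f ≋ f′ → g ≋ g′ → f *ₛ g ≋ f′ *ₛ g′
  *ₛ-cong f≋f′ g≋g′ n = sum≤-cong n (λ i → *-cong (f≋f′ i) (g≋g′ (n ∸ i)))

  *ₛ-assoc : ∀ f g h → (f *ₛ g) *ₛ h ≋ f *ₛ (g *ₛ h)
  *ₛ-assoc f g h n = begin
    sum≤ n (λ i → sum≤ i (λ a → f a * g (i ∸ a)) * h (n ∸ i))
      ≈⟨ sum≤-cong n (λ i → *-distribʳ-sum≤ i _ _) ⟩
    sum≤ n (λ i → sum≤ i (λ a → (f a * g (i ∸ a)) * h (n ∸ i)))
      ≈⟨ sum≤-triangle n _ ⟩
    sum≤ n (λ a → sum≤ (n ∸ a) (λ b → (f a * g (a ℕ.+ b ∸ a)) * h (n ∸ (a ℕ.+ b))))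
      ≈⟨ sum≤-cong n (λ a → sum≤-cong (n ∸ a) (λ b → trans (*-assoc _ _ _) (*-congˡ (reindex a b)))) ⟩
    sum≤ n (λ a → sum≤ (n ∸ a) (λ b → f a * (g b * h (n ∸ a ∸ b))))
      ≈⟨ sum≤-cong n (λ a → *-distribˡ-sum≤ (n ∸ a) _ _) ⟨
    sum≤ n (λ a → f a * sum≤ (n ∸ a) (λ b → g b * h (n ∸ a ∸ b))) ∎
    where
    reindex : ∀ a b → g (a ℕ.+ b ∸ a) * h (n ∸ (a ℕ.+ b)) ≈ g b * h (n ∸ a ∸ b)
    reindex a b = *-cong (reflexive (≡.cong g (ℕ.m+n∸m≡n a b)))
                         (reflexive (≡.cong h (≡.sym (ℕ.∸-+-assoc n a b))))

  *ₛ-distribˡ-+ₛ : ∀ f g h → f *ₛ (g +ₛ h) ≋ f *ₛ g +ₛ f *ₛ h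
  *ₛ-distribˡ-+ₛ f g h n = trans (sum≤-cong n (λ i → distribˡ _ _ _)) (sum≤-distrib-+ n _ _)

  *ₛ-distribʳ-+ₛ : ∀ f g h → (g +ₛ h) *ₛ f ≋ g *ₛ f +ₛ h *ₛ f
  *ₛ-distribʳ-+ₛ f g h n = trans (sum≤-cong n (λ i → distribʳ _ _ _)) (sum≤-distrib-+ n _ _)

  constantₛ-*ₛ : ∀ a f → constantₛ a *ₛ f ≋ (λ n → a * f n)
  constantₛ-*ₛ a f zero    = refl
  constantₛ-*ₛ a f (suc n) = begin
    sum≤ (suc n) (λ i → constantₛ a i * f (suc n ∸ i)) ≈⟨ sum≤-unfoldˡ n _ ⟩
    a * f (suc n) + sum≤ n (λ i → 0# * f (n ∸ i))      ≈⟨ +-congˡ (sum≤-zero n (λ i → zeroˡ _)) ⟩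
    a * f (suc n) + 0#                                 ≈⟨ +-identityʳ _ ⟩
    a * f (suc n)                                      ∎

  *ₛ-identityˡ : ∀ f → 1ₛ *ₛ f ≋ f
  *ₛ-identityˡ f n = trans (constantₛ-*ₛ 1# f n) (*-identityˡ (f n))

  *ₛ-identityʳ : ∀ f → f *ₛ 1ₛ ≋ f
  *ₛ-identityʳ f n = trans (*ₛ-comm f 1ₛ n) (*ₛ-identityˡ f n)

  xₛ-*ₛ : ∀ f → xₛ *ₛ f ≋ shift f
  xₛ-*ₛ f zero    = zeroˡ _
  xₛ-*ₛ f (suc n) = begin
    sum≤ (suc n) (λ i → xₛ i * f (suc n ∸ i))          ≈⟨ sum≤-unfoldˡ n _ ⟩
    0# * f (suc n) + sum≤ n (λ i → xₛ (suc i) * f (n ∸ i)) ≈⟨ +-cong (zeroˡ _) (constantₛ-*ₛ 1# f n) ⟩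
    0# + 1# * f n                                       ≈⟨ trans (+-identityˡ _) (*-identityˡ _) ⟩
    f n                                                 ∎

  isCommutativeRingₛ : IsCommutativeRing _≋_ _+ₛ_ _*ₛ_ -ₛ_ 0ₛ 1ₛ
  isCommutativeRingₛ = record
    { isRing = record
      { +-isAbelianGroup = Pointwise.isAbelianGroup ℕ +-isAbelianGroup
      ; *-cong = *ₛ-cong
      ; *-assoc = *ₛ-assoc
      ; *-identity = *ₛ-identityˡ , *ₛ-identityʳ
      ; distrib = *ₛ-distribˡ-+ₛ , *ₛ-distribʳ-+ₛ }
    ; *-comm = *ₛ-comm }

  commutativeRingₛ : CommutativeRing c ℓ
  commutativeRingₛ = record { isCommutativeRing = isCommutativeRingₛ }

open import Defs

module Bivariate where
  open import Data.Integer as ℤ using (ℤ; +_)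
  import Data.Integer.Properties as ℤ
  open import Data.Maybe using (Maybe; just; nothing)
  open import Algebra.Solver.Ring.AlmostCommutativeRing
    using (fromCommutativeRing; _-Raw-AlmostCommutative⟶_)

  module ℤ[[y]]      = PowerSeries ℤ.+-*-commutativeRing
  -- f : PS is read as Σₙ (Σₖ f n k yᵏ) xⁿ.
  module ℤ[[y]][[x]] = PowerSeries ℤ[[y]].commutativeRingₛ
  private module R = CommutativeRing ℤ[[y]][[x]].commutativeRingₛ
  open import Relation.Binary.Reasoning.Setoid R.setoid

  Σ≤-cong≤ : ∀ n {f g : ℕ → ℤ} → (∀ i → i ℕ.≤ n → f i ≡ g i) → Σ≤ n f ≡ Σ≤ n g
  Σ≤-cong≤ zero    f≡g = f≡g 0 z≤n
  Σ≤-cong≤ (suc n) f≡g = ≡.cong₂ ℤ._+_ (Σ≤-cong≤ n (λ i i≤n → f≡g i (ℕ.m≤n⇒m≤1+n i≤n))) (f≡g (suc n) ℕ.≤-refl)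

  Σ≤-cong : ∀ n {f g : ℕ → ℤ} → (∀ i → f i ≡ g i) → Σ≤ n f ≡ Σ≤ n g
  Σ≤-cong n f≡g = Σ≤-cong≤ n (λ i _ → f≡g i)

  ℤ[[y]]-sum≤≡Σ≤ : ∀ n f → ℤ[[y]].sum≤ n f ≡ Σ≤ n f
  ℤ[[y]]-sum≤≡Σ≤ zero    f = ≡.refl
  ℤ[[y]]-sum≤≡Σ≤ (suc n) f = ≡.cong (ℤ._+ f (suc n)) (ℤ[[y]]-sum≤≡Σ≤ n f)

  ℤ[[y]][[x]]-sum≤-coefficient : ∀ n φ k → ℤ[[y]][[x]].sum≤ n φ k ≡ Σ≤ n (λ i → φ i k)
  ℤ[[y]][[x]]-sum≤-coefficient zero    φ k = ≡.refl
  ℤ[[y]][[x]]-sum≤-coefficient (suc n) φ k = ≡.cong (ℤ._+ φ (suc n) k) (ℤ[[y]][[x]]-sum≤-coefficient n φ k)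

  ⊗≈*ₛ : ∀ f g → f ⊗ g ≈ f ℤ[[y]][[x]].*ₛ g
  ⊗≈*ₛ f g n k = ≡.sym (≡.trans (ℤ[[y]][[x]]-sum≤-coefficient n _ k) (Σ≤-cong n (λ i → ℤ[[y]]-sum≤≡Σ≤ k _)))

  one≈1ₛ : one ≈ ℤ[[y]][[x]].1ₛ
  one≈1ₛ zero    zero    = ≡.refl
  one≈1ₛ zero    (suc k) = ≡.refl
  one≈1ₛ (suc n) k       = ≡.refl

  X≈xₛ : X ≈ ℤ[[y]][[x]].xₛ
  X≈xₛ zero          k       = ≡.refl
  X≈xₛ 1             zero    = ≡.refl
  X≈xₛ 1             (suc k) = ≡.refl
  X≈xₛ (suc (suc n)) k       = ≡.refl

  Y≈yₛ : Y ≈ ℤ[[y]][[x]].constantₛ ℤ[[y]].xₛ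
  Y≈yₛ zero    zero          = ≡.refl
  Y≈yₛ zero    1             = ≡.refl
  Y≈yₛ zero    (suc (suc k)) = ≡.refl
  Y≈yₛ (suc n) k             = ≡.refl

  ⊗-cong : ∀ {f f′ g g′} → f ≈ f′ → g ≈ g′ → f ⊗ g ≈ f′ ⊗ g′
  ⊗-cong {f} {f′} {g} {g′} f≈f′ g≈g′ = begin
    f ⊗ g                   ≈⟨ ⊗≈*ₛ f g ⟩
    f ℤ[[y]][[x]].*ₛ g      ≈⟨ ℤ[[y]][[x]].*ₛ-cong f≈f′ g≈g′ ⟩
    f′ ℤ[[y]][[x]].*ₛ g′    ≈⟨ ⊗≈*ₛ f′ g′ ⟨
    f′ ⊗ g′                 ∎

  ⊗-comm : ∀ f g → f ⊗ g ≈ g ⊗ f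
  ⊗-comm f g = R.trans (⊗≈*ₛ f g) (R.trans (ℤ[[y]][[x]].*ₛ-comm f g) (R.sym (⊗≈*ₛ g f)))

  ⊗-assoc : ∀ f g h → (f ⊗ g) ⊗ h ≈ f ⊗ (g ⊗ h)
  ⊗-assoc f g h = begin
    (f ⊗ g) ⊗ h                                           ≈⟨ ⊗≈*ₛ (f ⊗ g) h ⟩
    (f ⊗ g) ℤ[[y]][[x]].*ₛ h                              ≈⟨ ℤ[[y]][[x]].*ₛ-cong {f ⊗ g} {g′ = h} (⊗≈*ₛ f g) R.refl ⟩
    (f ℤ[[y]][[x]].*ₛ g) ℤ[[y]][[x]].*ₛ h                 ≈⟨ ℤ[[y]][[x]].*ₛ-assoc f g h ⟩
    f ℤ[[y]][[x]].*ₛ (g ℤ[[y]][[x]].*ₛ h)                 ≈⟨ ℤ[[y]][[x]].*ₛ-cong {f} {f} {g ⊗ h} R.refl (⊗≈*ₛ g h) ⟨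
    f ℤ[[y]][[x]].*ₛ (g ⊗ h)                              ≈⟨ ⊗≈*ₛ f (g ⊗ h) ⟨
    f ⊗ (g ⊗ h)                                           ∎

  ⊗-identityˡ : ∀ f → one ⊗ f ≈ f
  ⊗-identityˡ f = begin
    one ⊗ f                           ≈⟨ ⊗-cong {g = f} one≈1ₛ R.refl ⟩
    ℤ[[y]][[x]].1ₛ ⊗ f                ≈⟨ ⊗≈*ₛ ℤ[[y]][[x]].1ₛ f ⟩
    ℤ[[y]][[x]].1ₛ ℤ[[y]][[x]].*ₛ f   ≈⟨ ℤ[[y]][[x]].*ₛ-identityˡ f ⟩
    f                                 ∎

  ⊗-distribˡ-⊕ : ∀ f g h → f ⊗ (g ⊕ h) ≈ f ⊗ g ⊕ f ⊗ h
  ⊗-distribˡ-⊕ f g h = begin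
    f ⊗ (g ⊕ h)                                           ≈⟨ ⊗≈*ₛ f (g ⊕ h) ⟩
    f ℤ[[y]][[x]].*ₛ (g ⊕ h)                              ≈⟨ ℤ[[y]][[x]].*ₛ-distribˡ-+ₛ f g h ⟩
    f ℤ[[y]][[x]].*ₛ g ⊕ f ℤ[[y]][[x]].*ₛ h               ≈⟨ R.+-cong (⊗≈*ₛ f g) (⊗≈*ₛ f h) ⟨
    f ⊗ g ⊕ f ⊗ h                                         ∎

  isCommutativeRing : IsCommutativeRing _≈_ _⊕_ _⊗_ ⊝_ ℤ[[y]][[x]].0ₛ one
  isCommutativeRing = record
    { isRing = record
      { +-isAbelianGroup = R.+-isAbelianGroup
      ; *-cong = ⊗-cong
      ; *-assoc = ⊗-assoc
      ; *-identity = ⊗-identityˡ , λ f → R.trans (⊗-comm f one) (⊗-identityˡ f)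
      ; distrib = ⊗-distribˡ-⊕ , λ f g h → R.trans (⊗-comm (g ⊕ h) f)
                    (R.trans (⊗-distribˡ-⊕ f g h) (R.+-cong (⊗-comm f g) (⊗-comm f h))) }
    ; *-comm = ⊗-comm }

  commutativeRing : CommutativeRing _ _
  commutativeRing = record { isCommutativeRing = isCommutativeRing }

  Σ≤-zero : ∀ n {f : ℕ → ℤ} → (∀ i → f i ≡ + 0) → Σ≤ n f ≡ + 0
  Σ≤-zero zero    f≡0 = f≡0 0
  Σ≤-zero (suc n) f≡0 = ≡.cong₂ ℤ._+_ (Σ≤-zero n f≡0) (f≡0 (suc n))

  const-homomorphism : CommutativeRing.rawRing ℤ.+-*-commutativeRing
                       -Raw-AlmostCommutative⟶ fromCommutativeRing commutativeRing
  const-homomorphism = record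
    { ⟦_⟧    = const
    ; +-homo = +-homo
    ; *-homo = *-homo
    ; -‿homo = -‿homo
    ; 0-homo = 0-homo
    ; 1-homo = λ _ _ → ≡.refl }
    where
    +-homo : ∀ a b → const (a ℤ.+ b) ≈ const a ⊕ const b
    +-homo a b zero    zero    = ≡.refl
    +-homo a b zero    (suc k) = ≡.refl
    +-homo a b (suc n) k       = ≡.refl
    -‿homo : ∀ a → const (ℤ.- a) ≈ ⊝ const a
    -‿homo a zero    zero    = ≡.refl
    -‿homo a zero    (suc k) = ≡.refl
    -‿homo a (suc n) k       = ≡.refl
    0-homo : const (+ 0) ≈ ℤ[[y]][[x]].0ₛ
    0-homo zero    zero    = ≡.refl
    0-homo zero    (suc k) = ≡.refl
    0-homo (suc n) k       = ≡.refl
    *-homo : ∀ a b → const (a ℤ.* b) ≈ const a ⊗ const b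
    *-homo a b zero    zero    = ≡.refl
    *-homo a b zero    (suc k) = ≡.sym (Σ≤-zero (suc k) λ { zero → ℤ.*-zeroʳ a ; (suc j) → ≡.refl })
    *-homo a b (suc n) k       = ≡.sym (Σ≤-zero (suc n) λ
      { zero    → Σ≤-zero k (λ { zero → ℤ.*-zeroʳ a ; (suc j) → ≡.refl })
      ; (suc i) → Σ≤-zero k (λ _ → ≡.refl) })

  coefficient≟ : ∀ a b → Maybe (const a ≈ const b)
  coefficient≟ a b with a ℤ.≟ b
  ... | yes ≡.refl = just R.refl
  ... | no _       = nothing

  open import Algebra.Solver.Ring (CommutativeRing.rawRing ℤ.+-*-commutativeRing)
    (fromCommutativeRing commutativeRing) const-homomorphism coefficient≟ public

  ⊕-congˡ : ∀ f {g g′} → g ≈ g′ → f ⊕ g ≈ f ⊕ g′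
  ⊕-congˡ f = CommutativeRing.+-congˡ commutativeRing {f}

  ⊕-congʳ : ∀ h {g g′} → g ≈ g′ → g ⊕ h ≈ g′ ⊕ h
  ⊕-congʳ h = CommutativeRing.+-congʳ commutativeRing {h}

  ⊗-congˡ : ∀ f {g g′} → g ≈ g′ → f ⊗ g ≈ f ⊗ g′
  ⊗-congˡ f = CommutativeRing.*-congˡ commutativeRing {f}

  ⊗-congʳ : ∀ h {g g′} → g ≈ g′ → g ⊗ h ≈ g′ ⊗ h
  ⊗-congʳ h = CommutativeRing.*-congʳ commutativeRing {h}

  ⊝-cong : ∀ {f f′} → f ≈ f′ → ⊝ f ≈ ⊝ f′
  ⊝-cong = CommutativeRing.-‿cong commutativeRing

  shiftₓ shiftᵧ : PS → PS
  shiftₓ = ℤ[[y]][[x]].shift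
  shiftᵧ f n = ℤ[[y]].shift (f n)

  X⊗≈shiftₓ : ∀ f → X ⊗ f ≈ shiftₓ f
  X⊗≈shiftₓ f = begin
    X ⊗ f                              ≈⟨ ⊗-cong {g = f} X≈xₛ R.refl ⟩
    ℤ[[y]][[x]].xₛ ⊗ f                 ≈⟨ ⊗≈*ₛ ℤ[[y]][[x]].xₛ f ⟩
    ℤ[[y]][[x]].xₛ ℤ[[y]][[x]].*ₛ f    ≈⟨ ℤ[[y]][[x]].xₛ-*ₛ f ⟩
    shiftₓ f                           ∎

  Y⊗≈shiftᵧ : ∀ f → Y ⊗ f ≈ shiftᵧ f
  Y⊗≈shiftᵧ f = begin
    Y ⊗ f                                                   ≈⟨ ⊗-cong {g = f} Y≈yₛ R.refl ⟩
    yₛ ⊗ f                                                  ≈⟨ ⊗≈*ₛ yₛ f ⟩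
    yₛ ℤ[[y]][[x]].*ₛ f                                     ≈⟨ ℤ[[y]][[x]].constantₛ-*ₛ ℤ[[y]].xₛ f ⟩
    (λ n → ℤ[[y]].xₛ ℤ[[y]].*ₛ f n)                         ≈⟨ (λ n → ℤ[[y]].xₛ-*ₛ (f n)) ⟩
    shiftᵧ f                                                ∎
    where
    yₛ : PS
    yₛ = ℤ[[y]][[x]].constantₛ ℤ[[y]].xₛ

module Telescoping where
  open import Data.Integer using (+_)
  open Bivariate
  private module R = CommutativeRing commutativeRing
  open import Relation.Binary.Reasoning.Setoid R.setoid

  vanishing-correction : ∀ {s p} b c → s ≈ b ⊕ c ⊗ (p ⊖ one) → p ≈ one → s ≈ b
  vanishing-correction {s} {p} b c s≈ p≈1 = begin
    s                     ≈⟨ s≈ ⟩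
    b ⊕ c ⊗ (p ⊖ one)     ≈⟨ ⊕-congˡ b (⊗-congˡ c (⊕-congʳ (⊝ one) p≈1)) ⟩
    b ⊕ c ⊗ (one ⊖ one)   ≈⟨ solve 2 (λ b c → b :+ c :* (con (+ 1) :- con (+ 1)) := b) R.refl b c ⟩
    b                     ∎

  telescope-base : ∀ {e₁ e₂ a₁ a₂ b t : PS} →
    e₁ ≈ one ⊕ a₁ → a₁ ≈ b ⊗ e₁ → e₂ ≈ e₁ ⊕ a₂ → a₂ ≈ t ⊗ (a₁ ⊗ e₂) →
    e₂ ⊗ (one ⊖ b ⊖ t ⊗ b) ≈ one
  telescope-base {e₁} {e₂} {a₁} {a₂} {b} {t} e₁≈ a₁≈ e₂≈ a₂≈ = begin
    e₂ ⊗ (one ⊖ b ⊖ t ⊗ b)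
      ≈⟨ solve 3 (λ e₂ b t → e₂ :* (con (+ 1) :- b :- t :* b) := e₂ :* (con (+ 1) :- b) :- t :* b :* e₂)
                 R.refl e₂ b t ⟩
    e₂ ⊗ (one ⊖ b) ⊖ t ⊗ b ⊗ e₂
      ≈⟨ ⊕-congʳ (⊝ (t ⊗ b ⊗ e₂)) (⊗-congʳ (one ⊖ b)
           (R.trans e₂≈ (⊕-congˡ e₁ (R.trans a₂≈ (⊗-congˡ t (⊗-congʳ e₂ a₁≈)))))) ⟩
    (e₁ ⊕ t ⊗ ((b ⊗ e₁) ⊗ e₂)) ⊗ (one ⊖ b) ⊖ t ⊗ b ⊗ e₂
      ≈⟨ solve 4 (λ e₁ e₂ b t → (e₁ :+ t :* ((b :* e₁) :* e₂)) :* (con (+ 1) :- b) :- t :* b :* e₂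
                                := (e₁ :* (con (+ 1) :- b)) :* (con (+ 1) :+ t :* b :* e₂) :- t :* b :* e₂)
                 R.refl e₁ e₂ b t ⟩
    (e₁ ⊗ (one ⊖ b)) ⊗ (one ⊕ t ⊗ b ⊗ e₂) ⊖ t ⊗ b ⊗ e₂
      ≈⟨ ⊕-congʳ (⊝ (t ⊗ b ⊗ e₂)) (⊗-congʳ (one ⊕ t ⊗ b ⊗ e₂) e₁⊗[1-b]≈1) ⟩
    one ⊗ (one ⊕ t ⊗ b ⊗ e₂) ⊖ t ⊗ b ⊗ e₂
      ≈⟨ solve 3 (λ e₂ b t → con (+ 1) :* (con (+ 1) :+ t :* b :* e₂) :- t :* b :* e₂ := con (+ 1))
                 R.refl e₂ b t ⟩
    one ∎
    where
    e₁⊗[1-b]≈1 : e₁ ⊗ (one ⊖ b) ≈ one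
    e₁⊗[1-b]≈1 = begin
      e₁ ⊗ (one ⊖ b)           ≈⟨ solve 2 (λ e₁ b → e₁ :* (con (+ 1) :- b) := e₁ :- b :* e₁) R.refl e₁ b ⟩
      e₁ ⊖ b ⊗ e₁              ≈⟨ ⊕-congʳ (⊝ (b ⊗ e₁)) (R.trans e₁≈ (⊕-congˡ one a₁≈)) ⟩
      one ⊕ b ⊗ e₁ ⊖ b ⊗ e₁    ≈⟨ solve 2 (λ e₁ b → con (+ 1) :+ b :* e₁ :- b :* e₁ := con (+ 1)) R.refl e₁ b ⟩
      one                      ∎

  -- e₃ = e₂ + t²a₁e₂e₃, so e₃Q₀ = 1 + t²a₁e₃ because e₂Q₀ = 1.
  telescope-step : ∀ {e₂ e₃ a₁ a₂ a₃ t Q₀ Q₁ : PS} →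
    Q₁ ≈ Q₀ ⊖ t ⊗ t ⊗ a₁ → e₃ ≈ e₂ ⊕ a₃ → a₃ ≈ t ⊗ (a₂ ⊗ e₃) → a₂ ≈ t ⊗ (a₁ ⊗ e₂) →
    e₂ ⊗ Q₀ ≈ one → e₃ ⊗ Q₁ ≈ one
  telescope-step {e₂} {e₃} {a₁} {a₂} {a₃} {t} {Q₀} {Q₁} Q₁≈ e₃≈ a₃≈ a₂≈ e₂⊗Q₀≈1 = begin
    e₃ ⊗ Q₁
      ≈⟨ ⊗-congˡ e₃ Q₁≈ ⟩
    e₃ ⊗ (Q₀ ⊖ t ⊗ t ⊗ a₁)
      ≈⟨ solve 4 (λ e₃ Q₀ t a₁ → e₃ :* (Q₀ :- t :* t :* a₁) := e₃ :* Q₀ :- t :* t :* a₁ :* e₃)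
                 R.refl e₃ Q₀ t a₁ ⟩
    e₃ ⊗ Q₀ ⊖ t ⊗ t ⊗ a₁ ⊗ e₃
      ≈⟨ ⊕-congʳ (⊝ (t ⊗ t ⊗ a₁ ⊗ e₃)) (⊗-congʳ Q₀
           (R.trans e₃≈ (⊕-congˡ e₂ (R.trans a₃≈ (⊗-congˡ t (⊗-congʳ e₃ a₂≈)))))) ⟩
    (e₂ ⊕ t ⊗ ((t ⊗ (a₁ ⊗ e₂)) ⊗ e₃)) ⊗ Q₀ ⊖ t ⊗ t ⊗ a₁ ⊗ e₃
      ≈⟨ solve 5 (λ e₂ e₃ Q₀ t a₁ → (e₂ :+ t :* ((t :* (a₁ :* e₂)) :* e₃)) :* Q₀ :- t :* t :* a₁ :* e₃
                                    := (e₂ :* Q₀) :* (con (+ 1) :+ t :* t :* a₁ :* e₃) :- t :* t :* a₁ :* e₃)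
                 R.refl e₂ e₃ Q₀ t a₁ ⟩
    (e₂ ⊗ Q₀) ⊗ (one ⊕ t ⊗ t ⊗ a₁ ⊗ e₃) ⊖ t ⊗ t ⊗ a₁ ⊗ e₃
      ≈⟨ ⊕-congʳ (⊝ (t ⊗ t ⊗ a₁ ⊗ e₃)) (⊗-congʳ (one ⊕ t ⊗ t ⊗ a₁ ⊗ e₃) e₂⊗Q₀≈1) ⟩
    one ⊗ (one ⊕ t ⊗ t ⊗ a₁ ⊗ e₃) ⊖ t ⊗ t ⊗ a₁ ⊗ e₃
      ≈⟨ solve 3 (λ e₃ t a₁ → con (+ 1) :* (con (+ 1) :+ t :* t :* a₁ :* e₃) :- t :* t :* a₁ :* e₃ := con (+ 1))
                 R.refl e₃ t a₁ ⟩
    one ∎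

  telescope : ∀ (e a Q : ℕ → PS) (b t : PS) →
    e 1 ≈ one ⊕ a 1 → a 1 ≈ b ⊗ e 1 →
    (∀ h → e (suc (suc h)) ≈ e (suc h) ⊕ a (suc (suc h))) →
    (∀ h → a (suc (suc h)) ≈ t ⊗ (a (suc h) ⊗ e (suc (suc h)))) →
    Q 0 ≈ one ⊖ b ⊖ t ⊗ b → (∀ h → Q (suc h) ≈ Q h ⊖ t ⊗ t ⊗ a (suc h)) →
    ∀ h → e (suc (suc h)) ⊗ Q h ≈ one
  telescope e a Q b t e₁≈ a₁≈ e≈ a≈ Q₀≈ Q≈ zero =
    R.trans (⊗-congˡ (e 2) Q₀≈) (telescope-base {e 1} {e 2} {a 1} {a 2} {b} {t} e₁≈ a₁≈ (e≈ 0) (a≈ 0))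
  telescope e a Q b t e₁≈ a₁≈ e≈ a≈ Q₀≈ Q≈ (suc h) =
    telescope-step {e (2 ℕ.+ h)} {e (3 ℕ.+ h)} {a (1 ℕ.+ h)} {a (2 ℕ.+ h)} {a (3 ℕ.+ h)} {t} {Q h} {Q (suc h)}
      (Q≈ h) (e≈ (suc h)) (a≈ (suc h)) (a≈ h) (telescope e a Q b t e₁≈ a₁≈ e≈ a≈ Q₀≈ Q≈ h)

module Truncation where
  import Data.Integer as ℤ
  open Bivariate using (Σ≤-cong; Σ≤-cong≤)

  infix 4 _≈[_]_
  _≈[_]_ : PS → ℕ → PS → Set
  f ≈[ N ] g = ∀ n → n ℕ.≤ N → ∀ k → f n k ≡ g n k

  ≈[]-refl : ∀ {N} f → f ≈[ N ] f
  ≈[]-refl f n n≤N k = ≡.refl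

  ⊕-truncated : ∀ {N f f′ g g′} → f ≈[ N ] f′ → g ≈[ N ] g′ → f ⊕ g ≈[ N ] f′ ⊕ g′
  ⊕-truncated f≈f′ g≈g′ n n≤N k = ≡.cong₂ ℤ._+_ (f≈f′ n n≤N k) (g≈g′ n n≤N k)

  ⊝-truncated : ∀ {N f f′} → f ≈[ N ] f′ → ⊝ f ≈[ N ] ⊝ f′
  ⊝-truncated f≈f′ n n≤N k = ≡.cong ℤ.-_ (f≈f′ n n≤N k)

  ⊗-truncated : ∀ {N f f′ g g′} → f ≈[ N ] f′ → g ≈[ N ] g′ → f ⊗ g ≈[ N ] f′ ⊗ g′
  ⊗-truncated f≈f′ g≈g′ n n≤N k = Σ≤-cong≤ n (λ i i≤n → Σ≤-cong k (λ j →
    ≡.cong₂ ℤ._*_ (f≈f′ i (ℕ.≤-trans i≤n n≤N) j) (g≈g′ (n ∸ i) (ℕ.≤-trans (ℕ.m∸n≤m n i) n≤N) (k ∸ j))))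

  Nonexpansive : (PS → PS) → Set
  Nonexpansive Φ = ∀ {N g g′} → g ≈[ N ] g′ → Φ g ≈[ N ] Φ g′

  -- The coefficients of xᴺ in Φ f ⊗ Ψ f only involve the coefficients of f up to xᴺ, where f agrees
  -- with both G (2 + N) and G N.
  ⊗≈one-in-the-limit : ∀ f (G : ℕ → PS) {Φ Ψ} → Nonexpansive Φ → Nonexpansive Ψ →
    (∀ N h → N ℕ.≤ h → f ≈[ N ] G h) →
    (∀ h → Φ (G (suc (suc h))) ⊗ Ψ (G h) ≈ one) →
    Φ f ⊗ Ψ f ≈ one
  ⊗≈one-in-the-limit f G Φ-nonexp Ψ-nonexp f≈G ΦG⊗ΨG≈1 N k =
    ≡.trans (⊗-truncated (Φ-nonexp (f≈G N (2 ℕ.+ N) (ℕ.m≤n+m N 2))) (Ψ-nonexp (f≈G N N ℕ.≤-refl)) N ℕ.≤-refl k)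
            (ΦG⊗ΨG≈1 N N k)

module ListSums where
  open import Data.List using (List; []; _∷_; _++_; concatMap; filter)
  open IntervalSums ℕ.+-*-commutativeSemiring using (sum≤)
  open import Algebra.Properties.CommutativeSemigroup ℕ.+-commutativeSemigroup using (interchange)

  sumBy : {A : Set} → (A → ℕ) → List A → ℕ
  sumBy f []      = 0
  sumBy f (x ∷ l) = f x ℕ.+ sumBy f l

  module _ {A : Set} where

    sumBy-cong : ∀ {f g : A → ℕ} l → (∀ x → f x ≡ g x) → sumBy f l ≡ sumBy g l
    sumBy-cong []      f≡g = ≡.refl
    sumBy-cong (x ∷ l) f≡g = ≡.cong₂ ℕ._+_ (f≡g x) (sumBy-cong l f≡g)

    sumBy-zero : ∀ {f : A → ℕ} l → (∀ x → f x ≡ 0) → sumBy f l ≡ 0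
    sumBy-zero []      f≡0 = ≡.refl
    sumBy-zero (x ∷ l) f≡0 = ≡.cong₂ ℕ._+_ (f≡0 x) (sumBy-zero l f≡0)

    sumBy-++ : ∀ (f : A → ℕ) l l′ → sumBy f (l ++ l′) ≡ sumBy f l ℕ.+ sumBy f l′
    sumBy-++ f []      l′ = ≡.refl
    sumBy-++ f (x ∷ l) l′ = ≡.trans (≡.cong (f x ℕ.+_) (sumBy-++ f l l′)) (≡.sym (ℕ.+-assoc (f x) _ _))

    sumBy-distrib-+ : ∀ (f g : A → ℕ) l → sumBy (λ x → f x ℕ.+ g x) l ≡ sumBy f l ℕ.+ sumBy g l
    sumBy-distrib-+ f g []      = ≡.refl
    sumBy-distrib-+ f g (x ∷ l) =
      ≡.trans (≡.cong (f x ℕ.+ g x ℕ.+_) (sumBy-distrib-+ f g l)) (interchange (f x) (g x) _ _)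

    *-distribˡ-sumBy : ∀ c (f : A → ℕ) l → c ℕ.* sumBy f l ≡ sumBy (λ x → c ℕ.* f x) l
    *-distribˡ-sumBy c f []      = ℕ.*-zeroʳ c
    *-distribˡ-sumBy c f (x ∷ l) = ≡.trans (ℕ.*-distribˡ-+ c (f x) _) (≡.cong (c ℕ.* f x ℕ.+_) (*-distribˡ-sumBy c f l))

    *-distribʳ-sumBy : ∀ c (f : A → ℕ) l → sumBy f l ℕ.* c ≡ sumBy (λ x → f x ℕ.* c) l
    *-distribʳ-sumBy c f l =
      ≡.trans (ℕ.*-comm _ c) (≡.trans (*-distribˡ-sumBy c f l) (sumBy-cong l (λ x → ℕ.*-comm c (f x))))

    sumBy-sum≤ : ∀ n (f : ℕ → A → ℕ) l → sumBy (λ x → sum≤ n (λ i → f i x)) l ≡ sum≤ n (λ i → sumBy (f i) l)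
    sumBy-sum≤ zero    f l = ≡.refl
    sumBy-sum≤ (suc n) f l =
      ≡.trans (sumBy-distrib-+ _ _ l) (≡.cong (ℕ._+ sumBy (f (suc n)) l) (sumBy-sum≤ n f l))

    sumBy-filter : ∀ (f : A → ℕ) (s : A → ℕ) n l →
      sumBy f (filter (λ x → s x ℕ.≟ n) l) ≡ sumBy (λ x → if s x ≡ᵇ n then f x else 0) l
    sumBy-filter f s n []      = ≡.refl
    sumBy-filter f s n (x ∷ l) with s x ≡ᵇ n
    ... | true  = ≡.cong (f x ℕ.+_) (sumBy-filter f s n l)
    ... | false = sumBy-filter f s n l

  module _ {A B : Set} where

    sumBy-concatMap : ∀ (f : B → ℕ) (g : A → List B) l → sumBy f (concatMap g l) ≡ sumBy (λ x → sumBy f (g x)) l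
    sumBy-concatMap f g []      = ≡.refl
    sumBy-concatMap f g (x ∷ l) = ≡.trans (sumBy-++ f (g x) (concatMap g l)) (≡.cong (sumBy f (g x) ℕ.+_) (sumBy-concatMap f g l))

module Enumeration where
  open import Data.Bool.Properties using (if-eta; if-cong)
  open import Data.List using ([]; _∷_)
  open ListSums
  open IntervalSums ℕ.+-*-commutativeSemiring using (sum≤; sum≤-cong≤; sum≤-indicator)

  private
    sl : Dyck → ℕ
    sl = semilength

  sumBy-upTo-suc : ∀ m (g : Dyck → ℕ) → sumBy g (upTo (suc m)) ≡
    g ε ℕ.+ sumBy (λ α → sumBy (λ β → if sl α ℕ.+ sl β ≤ᵇ m then g (node α β) else 0) (upTo m)) (upTo m)
  sumBy-upTo-suc m g = ≡.cong (g ε ℕ.+_) (≡.trans (sumBy-concatMap g _ (upTo m))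
    (sumBy-cong (upTo m) (λ α → ≡.trans (sumBy-concatMap g _ (upTo m))
      (sumBy-cong (upTo m) (λ β → sumBy-if (sl α ℕ.+ sl β ≤ᵇ m) (node α β))))))
    where
    sumBy-if : ∀ c P → sumBy g (if c then P ∷ [] else []) ≡ (if c then g P else 0)
    sumBy-if true  P = ℕ.+-identityʳ (g P)
    sumBy-if false P = ≡.refl

  sumBy-upTo-cong : ∀ m {f g : Dyck → ℕ} → (∀ P → sl P ℕ.≤ m → f P ≡ g P) →
    sumBy f (upTo m) ≡ sumBy g (upTo m)
  sumBy-upTo-cong zero    f≡g = ≡.cong (ℕ._+ 0) (f≡g ε z≤n)
  sumBy-upTo-cong (suc m) {f} {g} f≡g =
    ≡.trans (sumBy-upTo-suc m f)
      (≡.trans (≡.cong₂ ℕ._+_ (f≡g ε z≤n) (sumBy-cong (upTo m) (λ α → sumBy-cong (upTo m) (guarded α))))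
        (≡.sym (sumBy-upTo-suc m g)))
    where
    guarded : ∀ α β → (if sl α ℕ.+ sl β ≤ᵇ m then f (node α β) else 0)
                    ≡ (if sl α ℕ.+ sl β ≤ᵇ m then g (node α β) else 0)
    guarded α β with sl α ℕ.+ sl β ℕ.≤? m
    ... | yes ≤m rewrite ≤ᵇ-true ≤m = f≡g (node α β) (s≤s ≤m)
    ... | no  ≰m rewrite ≤ᵇ-false (ℕ.≰⇒> ≰m) = ≡.refl

  sumBy-upTo-suc-stable : ∀ m (g : Dyck → ℕ) → (∀ P → m ℕ.< sl P → g P ≡ 0) →
    sumBy g (upTo (suc m)) ≡ sumBy g (upTo m)
  sumBy-upTo-suc-stable zero    g g≡0 rewrite g≡0 (node ε ε) (s≤s z≤n) = ≡.refl
  sumBy-upTo-suc-stable (suc m) g g≡0 =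
    ≡.trans (sumBy-upTo-suc (suc m) g) (≡.trans (≡.cong (g ε ℕ.+_) inner) (≡.sym (sumBy-upTo-suc m g)))
    where
    guarded : Dyck → Dyck → ℕ
    guarded α β = if sl α ℕ.+ sl β ≤ᵇ m then g (node α β) else 0
    guarded-suc : ∀ α β → (if sl α ℕ.+ sl β ≤ᵇ suc m then g (node α β) else 0) ≡ guarded α β
    guarded-suc α β with sl α ℕ.+ sl β ℕ.≤? m
    ... | yes ≤m rewrite ≤ᵇ-true ≤m | ≤ᵇ-true (ℕ.m≤n⇒m≤1+n ≤m) = ≡.refl
    ... | no ≰m rewrite g≡0 (node α β) (s≤s (ℕ.≰⇒> ≰m)) =
      ≡.trans (if-eta (sl α ℕ.+ sl β ≤ᵇ suc m)) (≡.sym (if-eta (sl α ℕ.+ sl β ≤ᵇ m)))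
    guarded≡0 : ∀ α β → m ℕ.< sl α ℕ.+ sl β → guarded α β ≡ 0
    guarded≡0 α β m<sl rewrite ≤ᵇ-false m<sl = ≡.refl
    inner : sumBy (λ α → sumBy (λ β → if sl α ℕ.+ sl β ≤ᵇ suc m then g (node α β) else 0) (upTo (suc m))) (upTo (suc m))
          ≡ sumBy (λ α → sumBy (guarded α) (upTo m)) (upTo m)
    inner = ≡.trans
      (sumBy-cong (upTo (suc m)) (λ α → ≡.trans (sumBy-cong (upTo (suc m)) (guarded-suc α))
        (sumBy-upTo-suc-stable m (guarded α) (λ β m<β → guarded≡0 α β (ℕ.<-≤-trans m<β (ℕ.m≤n+m (sl β) (sl α)))))))
      (sumBy-upTo-suc-stable m (λ α → sumBy (guarded α) (upTo m))
        (λ α m<α → sumBy-zero (upTo m) (λ β → guarded≡0 α β (ℕ.<-≤-trans m<α (ℕ.m≤m+n (sl α) (sl β))))))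

  sumBy-upTo-stable : ∀ {j m} (g : Dyck → ℕ) → j ℕ.≤ m → (∀ P → j ℕ.< sl P → g P ≡ 0) →
    sumBy g (upTo m) ≡ sumBy g (upTo j)
  sumBy-upTo-stable {j} g j≤m g≡0 = go (ℕ.≤⇒≤′ j≤m)
    where
    go : ∀ {m} → j ℕ.≤′ m → sumBy g (upTo m) ≡ sumBy g (upTo j)
    go ℕ.≤′-refl          = ≡.refl
    go (ℕ.≤′-step j≤′m) =
      ≡.trans (sumBy-upTo-suc-stable _ g (λ P m<P → g≡0 P (ℕ.≤-<-trans (ℕ.≤′⇒≤ j≤′m) m<P))) (go j≤′m)

  sumBy-dyck-cong : ∀ n {f g : Dyck → ℕ} → (∀ P → sl P ≡ n → f P ≡ g P) → sumBy f (dyck n) ≡ sumBy g (dyck n)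
  sumBy-dyck-cong n {f} {g} f≡g = ≡.trans (sumBy-filter f sl n (upTo n))
    (≡.trans (sumBy-cong (upTo n) on-slice) (≡.sym (sumBy-filter g sl n (upTo n))))
    where
    on-slice : ∀ P → (if sl P ≡ᵇ n then f P else 0) ≡ (if sl P ≡ᵇ n then g P else 0)
    on-slice P with sl P ℕ.≟ n
    ... | yes P≡n rewrite ≡ᵇ-true P≡n = f≡g P P≡n
    ... | no  P≢n rewrite ≡ᵇ-false P≢n = ≡.refl

  m+n≡ᵇo≡n≡ᵇo∸m : ∀ {m o} n → m ℕ.≤ o → (m ℕ.+ n ≡ᵇ o) ≡ (n ≡ᵇ o ∸ m)
  m+n≡ᵇo≡n≡ᵇo∸m {m} {o} n m≤o with n ℕ.≟ o ∸ m
  ... | yes n≡o∸m rewrite ≡ᵇ-true n≡o∸m = ≡ᵇ-true (≡.trans (≡.cong (m ℕ.+_) n≡o∸m) (ℕ.m+[n∸m]≡n m≤o))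
  ... | no  n≢o∸m rewrite ≡ᵇ-false n≢o∸m =
    ≡ᵇ-false (λ m+n≡o → n≢o∸m (≡.trans (≡.sym (ℕ.m+n∸m≡n m n)) (≡.cong (_∸ m) m+n≡o)))

  sumBy-dyck-suc : ∀ n (f : Dyck → ℕ) → sumBy f (dyck (suc n)) ≡
    sum≤ n (λ i → sumBy (λ α → sumBy (λ β → f (node α β)) (dyck (n ∸ i))) (dyck i))
  sumBy-dyck-suc n f = begin
    sumBy f (dyck (suc n))
      ≡⟨ sumBy-filter f sl (suc n) (upTo (suc n)) ⟩
    sumBy (λ P → if sl P ≡ᵇ suc n then f P else 0) (upTo (suc n))
      ≡⟨ sumBy-upTo-suc n (λ P → if sl P ≡ᵇ suc n then f P else 0) ⟩
    sumBy (λ α → sumBy (λ β → if sl α ℕ.+ sl β ≤ᵇ n then (if sl α ℕ.+ sl β ≡ᵇ n then f (node α β) else 0) else 0)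
                       (upTo n)) (upTo n)
      ≡⟨ sumBy-cong (upTo n) (λ α → sumBy-cong (upTo n) (λ β → drop-bound (sl α ℕ.+ sl β))) ⟩
    sumBy G (upTo n)
      ≡⟨ sumBy-upTo-cong n (λ α α≤n → ≡.sym (≡.trans (sum≤-indicator n (sl α) (λ _ → G α)) (if-cong (≤ᵇ-true α≤n)))) ⟩
    sumBy (λ α → sum≤ n (λ i → if sl α ≡ᵇ i then G α else 0)) (upTo n)
      ≡⟨ sumBy-sum≤ n _ (upTo n) ⟩
    sum≤ n (λ i → sumBy (λ α → if sl α ≡ᵇ i then G α else 0) (upTo n))
      ≡⟨ sum≤-cong≤ n column ⟩
    sum≤ n (λ i → sumBy (λ α → sumBy (λ β → f (node α β)) (dyck (n ∸ i))) (dyck i)) ∎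
    where
    open ≡.≡-Reasoning
    drop-bound : ∀ a {x} → (if a ≤ᵇ n then (if a ≡ᵇ n then x else 0) else 0) ≡ (if a ≡ᵇ n then x else 0)
    drop-bound a with a ℕ.≟ n
    ... | yes ≡.refl rewrite ≤ᵇ-true (ℕ.≤-refl {a}) = ≡.refl
    ... | no  a≢n    rewrite ≡ᵇ-false a≢n = if-eta (a ≤ᵇ n)
    G : Dyck → ℕ
    G α = sumBy (λ β → if sl α ℕ.+ sl β ≡ᵇ n then f (node α β) else 0) (upTo n)
    G′ : ℕ → Dyck → ℕ
    G′ i α = sumBy (λ β → f (node α β)) (dyck (n ∸ i))
    G≡G′ : ∀ α → sl α ℕ.≤ n → G α ≡ G′ (sl α) α
    G≡G′ α α≤n = begin
      G α
        ≡⟨ sumBy-cong (upTo n) (λ β → if-cong (m+n≡ᵇo≡n≡ᵇo∸m (sl β) α≤n)) ⟩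
      sumBy (λ β → if sl β ≡ᵇ n ∸ sl α then f (node α β) else 0) (upTo n)
        ≡⟨ sumBy-upTo-stable _ (ℕ.m∸n≤m n (sl α)) (λ β n∸α<β → if-cong (≡ᵇ-false (ℕ.>⇒≢ n∸α<β))) ⟩
      sumBy (λ β → if sl β ≡ᵇ n ∸ sl α then f (node α β) else 0) (upTo (n ∸ sl α))
        ≡⟨ sumBy-filter _ sl (n ∸ sl α) (upTo (n ∸ sl α)) ⟨
      G′ (sl α) α ∎
    column : ∀ i → i ℕ.≤ n → sumBy (λ α → if sl α ≡ᵇ i then G α else 0) (upTo n)
                           ≡ sumBy (λ α → sumBy (λ β → f (node α β)) (dyck (n ∸ i))) (dyck i)
    column i i≤n = begin
      sumBy (λ α → if sl α ≡ᵇ i then G α else 0) (upTo n)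
        ≡⟨ sumBy-upTo-stable _ i≤n (λ α i<α → if-cong (≡ᵇ-false (ℕ.>⇒≢ i<α))) ⟩
      sumBy (λ α → if sl α ≡ᵇ i then G α else 0) (upTo i)
        ≡⟨ sumBy-cong (upTo i) on-slice ⟩
      sumBy (λ α → if sl α ≡ᵇ i then G′ i α else 0) (upTo i)
        ≡⟨ sumBy-filter (G′ i) sl i (upTo i) ⟨
      sumBy (λ α → sumBy (λ β → f (node α β)) (dyck (n ∸ i))) (dyck i) ∎
      where
      on-slice : ∀ α → (if sl α ≡ᵇ i then G α else 0) ≡ (if sl α ≡ᵇ i then G′ i α else 0)
      on-slice α with sl α ℕ.≟ i
      ... | yes ≡.refl rewrite ≡ᵇ-true {sl α} ≡.refl = G≡G′ α i≤n
      ... | no  α≢i    rewrite ≡ᵇ-false α≢i = ≡.refl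

module Occurrences where
  open import Data.List using ([]; _∷_; _++_)
  import Data.List.Properties as List
  open import Data.Product using (Σ-syntax; _,_)
  open import Algebra.Properties.CommutativeSemigroup ℕ.+-commutativeSemigroup using (x∙yz≈y∙xz)

  junction : Step → Step → Step → Step → ℕ
  junction a b x y = if isPrefix (a ∷ b ∷ []) (x ∷ y ∷ []) then 1 else 0

  occ-[-] : ∀ a b x → occ (a ∷ b ∷ []) (x ∷ []) ≡ 0
  occ-[-] U b U = ≡.refl
  occ-[-] U b D = ≡.refl
  occ-[-] D b U = ≡.refl
  occ-[-] D b D = ≡.refl

  occ-++-∷ : ∀ a b w y w′ →
    occ (a ∷ b ∷ []) (w ++ y ∷ w′) ≡ occ (a ∷ b ∷ []) (w ++ y ∷ []) ℕ.+ occ (a ∷ b ∷ []) (y ∷ w′)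
  occ-++-∷ a b []           y w′ rewrite occ-[-] a b y = ≡.refl
  occ-++-∷ a b (x ∷ [])     y w′ rewrite occ-[-] a b y =
    ≡.cong (ℕ._+ occ (a ∷ b ∷ []) (y ∷ w′)) (≡.sym (ℕ.+-identityʳ (junction a b x y)))
  occ-++-∷ a b (x ∷ x′ ∷ w) y w′ =
    ≡.trans (≡.cong (junction a b x x′ ℕ.+_) (occ-++-∷ a b (x′ ∷ w) y w′)) (≡.sym (ℕ.+-assoc (junction a b x x′) _ _))

  word-node-ends-with-D : ∀ α β → Σ[ v ∈ Word ] word (node α β) ≡ v ++ D ∷ []
  word-node-ends-with-D α ε          = U ∷ word α , ≡.refl
  word-node-ends-with-D α (node γ δ) with word-node-ends-with-D γ δ
  ... | v , γδ≡v++D = U ∷ word α ++ D ∷ v ,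
    ≡.trans (≡.cong (λ w → U ∷ word α ++ D ∷ w) γδ≡v++D) (≡.cong (U ∷_) (≡.sym (List.++-assoc (word α) (D ∷ v) (D ∷ []))))

  -- Occurrences of ab in UαDβ across the steps U, D around α (inner) or across the D before β (outer).
  inner outer : Step → Step → Dyck → ℕ
  inner a b ε          = junction a b U D
  inner a b (node _ _) = junction a b U U ℕ.+ junction a b D D
  outer a b ε          = 0
  outer a b (node _ _) = junction a b D U

  occ-node : ∀ a b α β → occ (a ∷ b ∷ []) (word (node α β)) ≡
    (occ (a ∷ b ∷ []) (word α) ℕ.+ inner a b α) ℕ.+ (occ (a ∷ b ∷ []) (word β) ℕ.+ outer a b β)
  occ-node a b α β = ≡.trans (occ-++-∷ a b (U ∷ word α) D (word β)) (≡.cong₂ ℕ._+_ (occ-inside α) (occ-after β))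
    where
    p = a ∷ b ∷ []
    occ-after : ∀ β → occ p (D ∷ word β) ≡ occ p (word β) ℕ.+ outer a b β
    occ-after ε          = occ-[-] a b D
    occ-after (node γ δ) = ℕ.+-comm (junction a b D U) _
    occ-inside : ∀ α → occ p (U ∷ word α ++ D ∷ []) ≡ occ p (word α) ℕ.+ inner a b α
    occ-inside ε rewrite occ-[-] a b D = ℕ.+-identityʳ (junction a b U D)
    occ-inside (node γ δ) with word-node-ends-with-D γ δ
    ... | v , γδ≡v++D = begin
      junction a b U U ℕ.+ occ p (word (node γ δ) ++ D ∷ [])
        ≡⟨ ≡.cong (λ w → junction a b U U ℕ.+ occ p (w ++ D ∷ [])) γδ≡v++D ⟩
      junction a b U U ℕ.+ occ p ((v ++ D ∷ []) ++ D ∷ [])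
        ≡⟨ ≡.cong (λ w → junction a b U U ℕ.+ occ p w) (List.++-assoc v (D ∷ []) (D ∷ [])) ⟩
      junction a b U U ℕ.+ occ p (v ++ D ∷ D ∷ [])
        ≡⟨ ≡.cong (junction a b U U ℕ.+_) (occ-++-∷ a b v D (D ∷ [])) ⟩
      junction a b U U ℕ.+ (occ p (v ++ D ∷ []) ℕ.+ (junction a b D D ℕ.+ occ p (D ∷ [])))
        ≡⟨ ≡.cong (λ m → junction a b U U ℕ.+ (occ p m ℕ.+ (junction a b D D ℕ.+ occ p (D ∷ [])))) γδ≡v++D ⟨
      junction a b U U ℕ.+ (occ p (word (node γ δ)) ℕ.+ (junction a b D D ℕ.+ occ p (D ∷ [])))
        ≡⟨ ≡.cong (λ m → junction a b U U ℕ.+ (occ p (word (node γ δ)) ℕ.+ m))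
                  (≡.trans (≡.cong (junction a b D D ℕ.+_) (occ-[-] a b D)) (ℕ.+-identityʳ _)) ⟩
      junction a b U U ℕ.+ (occ p (word (node γ δ)) ℕ.+ junction a b D D)
        ≡⟨ x∙yz≈y∙xz (junction a b U U) (occ p (word (node γ δ))) (junction a b D D) ⟩
      occ p (word (node γ δ)) ℕ.+ (junction a b U U ℕ.+ junction a b D D) ∎
      where open ≡.≡-Reasoning

  additive : (Dyck → ℕ) → (Dyck → ℕ) → Dyck → ℕ
  additive e₁ e₂ ε          = 0
  additive e₁ e₂ (node α β) = (additive e₁ e₂ α ℕ.+ e₁ α) ℕ.+ (additive e₁ e₂ β ℕ.+ e₂ β)

  additive-cong : ∀ {e₁ e₁′ e₂ e₂′} → (∀ α → e₁ α ≡ e₁′ α) → (∀ β → e₂ β ≡ e₂′ β) →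
    ∀ P → additive e₁ e₂ P ≡ additive e₁′ e₂′ P
  additive-cong e₁≡ e₂≡ ε          = ≡.refl
  additive-cong e₁≡ e₂≡ (node α β) =
    ≡.cong₂ ℕ._+_ (≡.cong₂ ℕ._+_ (additive-cong e₁≡ e₂≡ α) (e₁≡ α)) (≡.cong₂ ℕ._+_ (additive-cong e₁≡ e₂≡ β) (e₂≡ β))

  occ≡additive : ∀ a b P → occ (a ∷ b ∷ []) (word P) ≡ additive (inner a b) (outer a b) P
  occ≡additive a b ε          = ≡.refl
  occ≡additive a b (node α β) = ≡.trans (occ-node a b α β)
    (≡.cong₂ ℕ._+_ (≡.cong (ℕ._+ inner a b α) (occ≡additive a b α)) (≡.cong (ℕ._+ outer a b β) (occ≡additive a b β)))

  occ-DD≡occ-UU : ∀ P → occ pDD (word P) ≡ occ pUU (word P)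
  occ-DD≡occ-UU P = ≡.trans (occ≡additive D D P) (≡.trans (additive-cong same-inner same-outer P) (≡.sym (occ≡additive U U P)))
    where
    same-inner : ∀ α → inner D D α ≡ inner U U α
    same-inner ε          = ≡.refl
    same-inner (node _ _) = ≡.refl
    same-outer : ∀ β → outer D D β ≡ outer U U β
    same-outer ε          = ≡.refl
    same-outer (node _ _) = ≡.refl

module GeneratingFunctions where
  open import Data.Bool using (_∧_)
  import Data.Bool as Bool
  import Data.Bool.Properties as Bool
  open import Data.Integer as ℤ using (+_)
  import Data.Integer.Properties as ℤ
  open import Data.List using (List; []; _∷_; filter; length)
  open IntervalSums ℕ.+-*-commutativeSemiring using (sum≤; sum≤-cong; sum≤-zero; sum≤-indicator)
  open ListSums
  open Enumeration
  open Occurrences using (additive)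
  open Bivariate using (Σ≤-cong; shiftₓ; shiftᵧ)
  open Truncation using (_≈[_]_)

  iverson : Bool → ℕ
  iverson b = if b then 1 else 0

  iverson-* : ∀ b x → iverson b ℕ.* x ≡ (if b then x else 0)
  iverson-* true  x = ℕ.+-identityʳ x
  iverson-* false x = ≡.refl

  countBy : (Dyck → Bool) → (Dyck → ℕ) → List Dyck → ℕ → ℕ
  countBy g s l k = sumBy (λ P → iverson (g P ∧ (s P ≡ᵇ k))) l

  GF : (Dyck → Bool) → (Dyck → ℕ) → PS
  GF g s n k = + countBy g s (dyck n) k

  length-filter : ∀ (b : Dyck → Bool) l → length (filter (λ P → b P Bool.≟ true) l) ≡ sumBy (iverson ∘ b) l
  length-filter b []      = ≡.refl
  length-filter b (P ∷ l) with b P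
  ... | true  = ≡.cong suc (length-filter b l)
  ... | false = length-filter b l

  F≈GF : ∀ p (s : Dyck → ℕ) → (∀ P → occ p (word P) ≡ s P) → F p ≈ GF inDh≥ s
  F≈GF p s occ≡s n k = ≡.cong +_ (≡.trans (length-filter _ (dyck n))
    (sumBy-cong (dyck n) (λ P → ≡.cong (λ m → iverson (inDh≥ P ∧ (m ≡ᵇ k))) (occ≡s P))))

  GF-cong : ∀ g {s s′ : Dyck → ℕ} → (∀ P → g P ≡ true → s P ≡ s′ P) → GF g s ≈ GF g s′
  GF-cong g {s} {s′} s≡s′ n k = ≡.cong +_ (sumBy-cong (dyck n) same-summand)
    where
    same-summand : ∀ P → iverson (g P ∧ (s P ≡ᵇ k)) ≡ iverson (g P ∧ (s′ P ≡ᵇ k))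
    same-summand P with g P in gP≡true
    ... | true  = ≡.cong (λ m → iverson (m ≡ᵇ k)) (s≡s′ P gP≡true)
    ... | false = ≡.refl

  GF-suc : ∀ g s → GF g (suc ∘ s) ≈ shiftᵧ (GF g s)
  GF-suc g s n zero    = ≡.cong +_ (sumBy-zero (dyck n) (λ P → ≡.cong iverson (Bool.∧-zeroʳ (g P))))
  GF-suc g s n (suc k) = ≡.refl

  GF-suc≡0 : ∀ g s n → (∀ α β → g (node α β) ≡ false) → ∀ k → GF g s (suc n) k ≡ + 0
  GF-suc≡0 g s n g-node≡false k = ≡.cong +_ (≡.trans (sumBy-dyck-suc n _)
    (sum≤-zero n (λ i → sumBy-zero (dyck i) (λ α → sumBy-zero (dyck (n ∸ i))
      (λ β → ≡.cong (λ b → iverson (b ∧ _)) (g-node≡false α β))))))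

  heightAtMost heightExactly : ℕ → Dyck → Bool
  heightAtMost  h P = inDh≥ P ∧ (height P ≤ᵇ h)
  heightExactly h P = inDh≥ P ∧ (height P ≡ᵇ h)

  0<height-node : ∀ α β → 0 ℕ.< height (node α β)
  0<height-node α β = ℕ.<-≤-trans (s≤s z≤n) (ℕ.m≤m⊔n (suc (height α)) (height β))

  heightAtMost-0-node : ∀ α β → heightAtMost 0 (node α β) ≡ false
  heightAtMost-0-node α β =
    ≡.trans (≡.cong (inDh≥ (node α β) ∧_) (≤ᵇ-false (0<height-node α β))) (Bool.∧-zeroʳ _)

  heightExactly-0-node : ∀ α β → heightExactly 0 (node α β) ≡ false
  heightExactly-0-node α β =
    ≡.trans (≡.cong (inDh≥ (node α β) ∧_) (≡ᵇ-false (ℕ.>⇒≢ (0<height-node α β)))) (Bool.∧-zeroʳ _)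

  GF-heightAtMost-0 : ∀ s → s ε ≡ 0 → GF (heightAtMost 0) s ≈ one
  GF-heightAtMost-0 s sε≡0 zero    zero    rewrite sε≡0 = ≡.refl
  GF-heightAtMost-0 s sε≡0 zero    (suc k) rewrite sε≡0 = ≡.refl
  GF-heightAtMost-0 s sε≡0 (suc n) k =
    GF-suc≡0 _ s n heightAtMost-0-node k

  GF-heightExactly-0 : ∀ s → s ε ≡ 0 → GF (heightExactly 0) s ≈ one
  GF-heightExactly-0 s sε≡0 zero    zero    rewrite sε≡0 = ≡.refl
  GF-heightExactly-0 s sε≡0 zero    (suc k) rewrite sε≡0 = ≡.refl
  GF-heightExactly-0 s sε≡0 (suc n) k =
    GF-suc≡0 _ s n heightExactly-0-node k

  GF-heightExactly-0-y : ∀ s → s ε ≡ 1 → GF (heightExactly 0) s ≈ Y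
  GF-heightExactly-0-y s sε≡1 zero    zero          rewrite sε≡1 = ≡.refl
  GF-heightExactly-0-y s sε≡1 zero    1             rewrite sε≡1 = ≡.refl
  GF-heightExactly-0-y s sε≡1 zero    (suc (suc k)) rewrite sε≡1 = ≡.refl
  GF-heightExactly-0-y s sε≡1 (suc n) k = GF-suc≡0 _ s n heightExactly-0-node k

  GF-heightAtMost-suc : ∀ h s → GF (heightAtMost (suc h)) s ≈ GF (heightAtMost h) s ⊕ GF (heightExactly (suc h)) s
  GF-heightAtMost-suc h s n k = ≡.trans
    (≡.cong +_ (≡.trans (sumBy-cong (dyck n) (λ P → split (inDh≥ P) (height P))) (sumBy-distrib-+ _ _ (dyck n))))
    (ℤ.pos-+ (countBy (heightAtMost h) s (dyck n) k) (countBy (heightExactly (suc h)) s (dyck n) k))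
    where
    split : ∀ c x {q} → iverson ((c ∧ (x ≤ᵇ suc h)) ∧ q) ≡ iverson ((c ∧ (x ≤ᵇ h)) ∧ q) ℕ.+ iverson ((c ∧ (x ≡ᵇ suc h)) ∧ q)
    split false x = ≡.refl
    split true  x {q} with ℕ.<-cmp x (suc h)
    ... | tri< x<1+h x≢1+h _
      rewrite ≤ᵇ-true (ℕ.<⇒≤ x<1+h) | ≤ᵇ-true (ℕ.m<1+n⇒m≤n x<1+h) | ≡ᵇ-false x≢1+h = ≡.sym (ℕ.+-identityʳ (iverson q))
    ... | tri≈ _ ≡.refl _ rewrite n<ᵇ1+n h | <ᵇ-irrefl h | ≡ᵇ-true {h} ≡.refl = ≡.refl
    ... | tri> _ x≢1+h 1+h<x
      rewrite ≤ᵇ-false 1+h<x | ≤ᵇ-false (ℕ.<-trans (ℕ.n<1+n h) 1+h<x) | ≡ᵇ-false x≢1+h = ≡.refl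

  -- Here the defining condition h(UαD) ≥ h(β) of D^{h,≥} makes the height of UαDβ equal to 1 + h(α).
  heightExactly-node : ∀ h α β → heightExactly (suc h) (node α β) ≡ (heightExactly h α ∧ heightAtMost (suc h) β)
  heightExactly-node h α β with inDh≥ α | inDh≥ β
  ... | false | _    = ≡.refl
  ... | true  | false = ≡.sym (Bool.∧-zeroʳ (height α ≡ᵇ h))
  ... | true  | true with height β ℕ.≤? suc (height α) | height α ℕ.≟ h
  ...   | yes β≤1+α | yes ≡.refl rewrite ≤ᵇ-true β≤1+α | ℕ.m≥n⇒m⊔n≡m β≤1+α | ≡ᵇ-true {height α} ≡.refl = ≡.refl
  ...   | yes β≤1+α | no  α≢h    rewrite ≤ᵇ-true β≤1+α | ℕ.m≥n⇒m⊔n≡m β≤1+α | ≡ᵇ-false α≢h = ≡.refl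
  ...   | no  β≰1+α | yes ≡.refl rewrite ≤ᵇ-false (ℕ.≰⇒> β≰1+α) | ≡ᵇ-true {height α} ≡.refl = ≡.refl
  ...   | no  β≰1+α | no  α≢h    rewrite ≤ᵇ-false (ℕ.≰⇒> β≰1+α) | ≡ᵇ-false α≢h = ≡.refl

  iverson-+≡ᵇ : ∀ c₁ c₂ x y k → iverson ((c₁ ∧ c₂) ∧ (x ℕ.+ y ≡ᵇ k)) ≡
    sum≤ k (λ j → iverson (c₁ ∧ (x ≡ᵇ j)) ℕ.* iverson (c₂ ∧ (y ≡ᵇ k ∸ j)))
  iverson-+≡ᵇ false c₂    x y k = ≡.sym (sum≤-zero k (λ j → ≡.refl))
  iverson-+≡ᵇ true  false x y k = ≡.sym (sum≤-zero k (λ j → ℕ.*-zeroʳ (iverson (x ≡ᵇ j))))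
  iverson-+≡ᵇ true  true  x y k = ≡.sym (≡.trans
    (sum≤-cong k (λ j → iverson-* (x ≡ᵇ j) _))
    (≡.trans (sum≤-indicator k x (λ j → iverson (y ≡ᵇ k ∸ j))) split-on-x))
    where
    split-on-x : (if x ≤ᵇ k then iverson (y ≡ᵇ k ∸ x) else 0) ≡ iverson (x ℕ.+ y ≡ᵇ k)
    split-on-x with x ℕ.≤? k
    ... | yes x≤k rewrite ≤ᵇ-true x≤k = ≡.cong iverson (≡.sym (m+n≡ᵇo≡n≡ᵇo∸m y x≤k))
    ... | no  x≰k rewrite ≤ᵇ-false (ℕ.≰⇒> x≰k) =
      ≡.cong iverson (≡.sym (≡ᵇ-false (ℕ.>⇒≢ (ℕ.<-≤-trans (ℕ.≰⇒> x≰k) (ℕ.m≤m+n x y)))))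

  countBy-product : ∀ (g₁ g₂ : Dyck → Bool) (s₁ s₂ : Dyck → ℕ) l₁ l₂ k →
    sumBy (λ α → sumBy (λ β → iverson ((g₁ α ∧ g₂ β) ∧ (s₁ α ℕ.+ s₂ β ≡ᵇ k))) l₂) l₁ ≡
    sum≤ k (λ j → countBy g₁ s₁ l₁ j ℕ.* countBy g₂ s₂ l₂ (k ∸ j))
  countBy-product g₁ g₂ s₁ s₂ l₁ l₂ k = begin
    sumBy (λ α → sumBy (λ β → iverson ((g₁ α ∧ g₂ β) ∧ (s₁ α ℕ.+ s₂ β ≡ᵇ k))) l₂) l₁
      ≡⟨ sumBy-cong l₁ (λ α → ≡.trans (sumBy-cong l₂ (λ β → iverson-+≡ᵇ (g₁ α) (g₂ β) (s₁ α) (s₂ β) k))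
                                      (sumBy-sum≤ k (λ j β → ι₁ j α ℕ.* ι₂ j β) l₂)) ⟩
    sumBy (λ α → sum≤ k (λ j → sumBy (λ β → ι₁ j α ℕ.* ι₂ j β) l₂)) l₁
      ≡⟨ sumBy-sum≤ k (λ j α → sumBy (λ β → ι₁ j α ℕ.* ι₂ j β) l₂) l₁ ⟩
    sum≤ k (λ j → sumBy (λ α → sumBy (λ β → ι₁ j α ℕ.* ι₂ j β) l₂) l₁)
      ≡⟨ sum≤-cong k (λ j → sumBy-cong l₁ (λ α → *-distribˡ-sumBy (ι₁ j α) (ι₂ j) l₂)) ⟨
    sum≤ k (λ j → sumBy (λ α → ι₁ j α ℕ.* countBy g₂ s₂ l₂ (k ∸ j)) l₁)
      ≡⟨ sum≤-cong k (λ j → *-distribʳ-sumBy (countBy g₂ s₂ l₂ (k ∸ j)) (ι₁ j) l₁) ⟨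
    sum≤ k (λ j → countBy g₁ s₁ l₁ j ℕ.* countBy g₂ s₂ l₂ (k ∸ j)) ∎
    where
    open ≡.≡-Reasoning
    ι₁ ι₂ : ℕ → Dyck → ℕ
    ι₁ j α = iverson (g₁ α ∧ (s₁ α ≡ᵇ j))
    ι₂ j β = iverson (g₂ β ∧ (s₂ β ≡ᵇ k ∸ j))

  +-sum≤ : ∀ n f → + sum≤ n f ≡ Σ≤ n (λ i → + f i)
  +-sum≤ zero    f = ≡.refl
  +-sum≤ (suc n) f = ≡.trans (ℤ.pos-+ (sum≤ n f) (f (suc n))) (≡.cong (ℤ._+ + f (suc n)) (+-sum≤ n f))

  +-convolution : ∀ n k (u v : ℕ → ℕ → ℕ) →
    + sum≤ n (λ i → sum≤ k (λ j → u i j ℕ.* v (n ∸ i) (k ∸ j))) ≡ ((λ i j → + u i j) ⊗ (λ i j → + v i j)) n k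
  +-convolution n k u v = ≡.trans (+-sum≤ n _) (Σ≤-cong n (λ i → ≡.trans (+-sum≤ k _)
    (Σ≤-cong k (λ j → ℤ.pos-* (u i j) (v (n ∸ i) (k ∸ j))))))

  GF-node : ∀ h e₁ e₂ → GF (heightExactly (suc h)) (additive e₁ e₂) ≈
    shiftₓ (GF (heightExactly h) (λ α → additive e₁ e₂ α ℕ.+ e₁ α) ⊗ GF (heightAtMost (suc h)) (λ β → additive e₁ e₂ β ℕ.+ e₂ β))
  GF-node h e₁ e₂ zero    k = ≡.refl
  GF-node h e₁ e₂ (suc n) k = ≡.trans (≡.cong +_ count-node) (+-convolution n k c₁ c₂)
    where
    s₁ s₂ : Dyck → ℕ
    s₁ α = additive e₁ e₂ α ℕ.+ e₁ α
    s₂ β = additive e₁ e₂ β ℕ.+ e₂ β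
    c₁ c₂ : ℕ → ℕ → ℕ
    c₁ i j = countBy (heightExactly h) s₁ (dyck i) j
    c₂ i j = countBy (heightAtMost (suc h)) s₂ (dyck i) j
    count-node : countBy (heightExactly (suc h)) (additive e₁ e₂) (dyck (suc n)) k
                 ≡ sum≤ n (λ i → sum≤ k (λ j → c₁ i j ℕ.* c₂ (n ∸ i) (k ∸ j)))
    count-node = ≡.trans (sumBy-dyck-suc n _) (sum≤-cong n (λ i → ≡.trans
      (sumBy-cong (dyck i) (λ α → sumBy-cong (dyck (n ∸ i)) (λ β →
        ≡.cong (λ b → iverson (b ∧ (s₁ α ℕ.+ s₂ β ≡ᵇ k))) (heightExactly-node h α β))))
      (countBy-product (heightExactly h) (heightAtMost (suc h)) s₁ s₂ (dyck i) (dyck (n ∸ i)) k)))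

  GF-+-nonempty : ∀ g (s e : Dyck → ℕ) → g ε ≡ true → s ε ≡ 0 → e ε ≡ 0 → (∀ α β → e (node α β) ≡ 1) →
    GF g (λ P → s P ℕ.+ e P) ≈ one ⊕ shiftᵧ (GF g s ⊖ one)
  GF-+-nonempty g s e gε sε eε e-node zero zero          rewrite gε | sε | eε = ≡.refl
  GF-+-nonempty g s e gε sε eε e-node zero 1             rewrite gε | sε | eε = ≡.refl
  GF-+-nonempty g s e gε sε eε e-node zero (suc (suc k)) rewrite gε | sε | eε = ≡.refl
  GF-+-nonempty g s e gε sε eε e-node (suc n) k = ≡.trans
    (≡.cong +_ (sumBy-dyck-cong (suc n) at-node))
    (≡.trans (GF-suc g s (suc n) k) (shiftᵧ-coefficient k))
    where
    at-node : ∀ P → semilength P ≡ suc n → iverson (g P ∧ (s P ℕ.+ e P ≡ᵇ k)) ≡ iverson (g P ∧ (suc (s P) ≡ᵇ k))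
    at-node (node α β) _ = ≡.cong (λ m → iverson (g (node α β) ∧ (m ≡ᵇ k)))
      (≡.trans (≡.cong (s (node α β) ℕ.+_) (e-node α β)) (ℕ.+-comm (s (node α β)) 1))
    shiftᵧ-coefficient : ∀ k → shiftᵧ (GF g s) (suc n) k ≡ (one ⊕ shiftᵧ (GF g s ⊖ one)) (suc n) k
    shiftᵧ-coefficient zero    = ≡.refl
    shiftᵧ-coefficient (suc k) = ≡.sym (≡.trans (ℤ.+-identityˡ _) (ℤ.+-identityʳ _))

  height≤semilength : ∀ P → height P ℕ.≤ semilength P
  height≤semilength ε          = z≤n
  height≤semilength (node α β) = ℕ.⊔-lub
    (s≤s (ℕ.≤-trans (height≤semilength α) (ℕ.m≤m+n _ _)))
    (ℕ.≤-trans (height≤semilength β) (ℕ.≤-trans (ℕ.m≤n+m _ (semilength α)) (ℕ.n≤1+n _)))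

  GF-heightAtMost-approximates : ∀ s h → GF inDh≥ s ≈[ h ] GF (heightAtMost h) s
  GF-heightAtMost-approximates s h n n≤h k = ≡.cong +_ (sumBy-dyck-cong n bounded)
    where
    bounded : ∀ P → semilength P ≡ n → iverson (inDh≥ P ∧ (s P ≡ᵇ k)) ≡ iverson (heightAtMost h P ∧ (s P ≡ᵇ k))
    bounded P P≡n rewrite ≤ᵇ-true (ℕ.≤-trans (height≤semilength P) (ℕ.≤-trans (ℕ.≤-reflexive P≡n) n≤h))
                        | Bool.∧-identityʳ (inDh≥ P) = ≡.refl

  GF-+-zero : ∀ g (s e : Dyck → ℕ) → (∀ P → e P ≡ 0) → GF g (λ P → s P ℕ.+ e P) ≈ GF g s
  GF-+-zero g s e e≡0 = GF-cong g (λ P _ → ≡.trans (≡.cong (s P ℕ.+_) (e≡0 P)) (ℕ.+-identityʳ (s P)))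

module HeightFiltration (a b : Step) where
  open import Data.List using ([]; _∷_)
  open Bivariate
  open Truncation using (_≈[_]_)
  open GeneratingFunctions
  open Occurrences
  private module R = CommutativeRing commutativeRing

  stat statˡ statʳ : Dyck → ℕ
  stat    = additive (inner a b) (outer a b)
  statˡ α = stat α ℕ.+ inner a b α
  statʳ β = stat β ℕ.+ outer a b β

  E A : ℕ → PS
  E h = GF (heightAtMost h) stat
  A h = GF (heightExactly h) stat

  E-0 : E 0 ≈ one
  E-0 = GF-heightAtMost-0 stat ≡.refl

  E-1 : E 1 ≈ one ⊕ A 1
  E-1 = R.trans (GF-heightAtMost-suc 0 stat) (⊕-congʳ (A 1) E-0)

  E-suc : ∀ h → E (suc h) ≈ E h ⊕ A (suc h)
  E-suc h = GF-heightAtMost-suc h stat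

  A-first-return : ∀ h → A (suc h) ≈ X ⊗ (GF (heightExactly h) statˡ ⊗ GF (heightAtMost (suc h)) statʳ)
  A-first-return h = R.trans (GF-node h (inner a b) (outer a b)) (R.sym (X⊗≈shiftₓ _))

  F≈[]E : ∀ N h → N ℕ.≤ h → F (a ∷ b ∷ []) ≈[ N ] E h
  F≈[]E N h N≤h n n≤N k = ≡.trans (F≈GF (a ∷ b ∷ []) stat (occ≡additive a b) n k)
                                   (GF-heightAtMost-approximates stat h n (ℕ.≤-trans n≤N N≤h) k)

module PatternUD where
  open import Data.Integer using (+_)
  open Bivariate
  open Telescoping
  open Truncation
  open GeneratingFunctions
  open Occurrences
  open HeightFiltration U D
  private module R = CommutativeRing commutativeRing

  outer-UD≡0 : ∀ β → outer U D β ≡ 0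
  outer-UD≡0 ε          = ≡.refl
  outer-UD≡0 (node _ _) = ≡.refl

  A-1 : A 1 ≈ (X ⊗ Y) ⊗ E 1
  A-1 = R.trans (A-first-return 0) (R.trans
    (⊗-congˡ X (⊗-cong (GF-heightExactly-0-y statˡ ≡.refl) (GF-+-zero (heightAtMost 1) stat (outer U D) outer-UD≡0)))
    (R.sym (R.*-assoc X Y (E 1))))

  A-2+ : ∀ h → A (2 ℕ.+ h) ≈ X ⊗ (A (suc h) ⊗ E (2 ℕ.+ h))
  A-2+ h = R.trans (A-first-return (suc h)) (⊗-congˡ X (⊗-cong
    (GF-cong (heightExactly (suc h)) {statˡ} {stat} λ { ε () ; (node α β) _ → ℕ.+-identityʳ _ })
    (GF-+-zero (heightAtMost (2 ℕ.+ h)) stat (outer U D) outer-UD≡0)))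

  Q : PS → PS
  Q f = A-UD ⊖ X ⊗ X ⊗ f

  E-telescopes : ∀ h → E (2 ℕ.+ h) ⊗ Q (E h) ≈ one
  E-telescopes = telescope E A (Q ∘ E) (X ⊗ Y) X E-1 A-1 (λ h → E-suc (suc h)) A-2+
    (R.trans (⊕-congˡ A-UD (⊝-cong (⊗-congˡ (X ⊗ X) E-0)))
      (solve 2 (λ x y → (x :* x :- x :* x :* y :- x :* y :+ con (+ 1)) :- x :* x :* con (+ 1)
                        := con (+ 1) :- x :* y :- x :* (x :* y)) R.refl X Y))
    (λ h → R.trans (⊕-congˡ A-UD (⊝-cong (⊗-congˡ (X ⊗ X) (E-suc h))))
      (solve 4 (λ a x e b → a :- x :* x :* (e :+ b) := a :- x :* x :* e :- x :* x :* b) R.refl A-UD X (E h) (A (suc h))))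

  F-quadratic : F pUD ⊗ Q (F pUD) ≈ one
  F-quadratic = ⊗≈one-in-the-limit (F pUD) E (λ f≈g → f≈g)
    (λ f≈g → ⊕-truncated (≈[]-refl A-UD) (⊝-truncated (⊗-truncated (≈[]-refl (X ⊗ X)) f≈g)))
    F≈[]E E-telescopes

  sqrt : ∀ f → f ⊗ Q f ≈ one → IsSqrtOf (A-UD ⊖ two ⊗ X ⊗ X ⊗ f) B-UD
  sqrt f f⊗Qf≈1 = ≡.refl , vanishing-correction B-UD (⊝ (const (+ 4) ⊗ X ⊗ X))
    (solve 3 (λ x y f →
      let A = x :* x :- x :* x :* y :- x :* y :+ con (+ 1)
          T = x :* x :* (y :- con (+ 1)) :+ x :* y :- con (+ 1) in
      (A :- con (+ 2) :* x :* x :* f) :* (A :- con (+ 2) :* x :* x :* f)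
        := (:- (con (+ 4) :* x :* x) :+ T :* T) :+ (:- (con (+ 4) :* x :* x)) :* (f :* (A :- x :* x :* f) :- con (+ 1)))
      R.refl X Y f)
    f⊗Qf≈1

module PatternUU where
  open import Data.Integer using (+_)
  open Bivariate
  open Telescoping
  open Truncation
  open GeneratingFunctions
  open Occurrences
  open HeightFiltration U U
  private module R = CommutativeRing commutativeRing

  outer-UU≡0 : ∀ β → outer U U β ≡ 0
  outer-UU≡0 ε          = ≡.refl
  outer-UU≡0 (node _ _) = ≡.refl

  A-1 : A 1 ≈ X ⊗ E 1
  A-1 = R.trans (A-first-return 0) (⊗-congˡ X (R.trans
    (⊗-cong (GF-heightExactly-0 statˡ ≡.refl) (GF-+-zero (heightAtMost 1) stat (outer U U) outer-UU≡0))
    (R.*-identityˡ (E 1))))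

  A-2+ : ∀ h → A (2 ℕ.+ h) ≈ (X ⊗ Y) ⊗ (A (suc h) ⊗ E (2 ℕ.+ h))
  A-2+ h = R.trans (A-first-return (suc h)) (R.trans (⊗-congˡ X (⊗-cong
    (R.trans (GF-cong (heightExactly (suc h)) {statˡ} {suc ∘ stat} λ { ε () ; (node α β) _ → ℕ.+-comm _ 1 })
             (R.trans (GF-suc (heightExactly (suc h)) stat) (R.sym (Y⊗≈shiftᵧ (A (suc h))))))
    (GF-+-zero (heightAtMost (2 ℕ.+ h)) stat (outer U U) outer-UU≡0)))
    (solve 4 (λ x y a e → x :* ((y :* a) :* e) := (x :* y) :* (a :* e)) R.refl X Y (A (suc h)) (E (2 ℕ.+ h))))

  Q : PS → PS
  Q f = A-UU ⊖ X ⊗ X ⊗ Y ⊗ Y ⊗ f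

  E-telescopes : ∀ h → E (2 ℕ.+ h) ⊗ Q (E h) ≈ one
  E-telescopes = telescope E A (Q ∘ E) X (X ⊗ Y) E-1 A-1 (λ h → E-suc (suc h)) A-2+
    (R.trans (⊕-congˡ A-UU (⊝-cong (⊗-congˡ (X ⊗ X ⊗ Y ⊗ Y) E-0)))
      (solve 2 (λ x y → (x :* x :* y :* y :- x :* x :* y :- x :+ con (+ 1)) :- x :* x :* y :* y :* con (+ 1)
                        := con (+ 1) :- x :- (x :* y) :* x) R.refl X Y))
    (λ h → R.trans (⊕-congˡ A-UU (⊝-cong (⊗-congˡ (X ⊗ X ⊗ Y ⊗ Y) (E-suc h))))
      (solve 5 (λ a x y e b → a :- x :* x :* y :* y :* (e :+ b) := a :- x :* x :* y :* y :* e :- (x :* y) :* (x :* y) :* b)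
        R.refl A-UU X Y (E h) (A (suc h))))

  F-quadratic : F pUU ⊗ Q (F pUU) ≈ one
  F-quadratic = ⊗≈one-in-the-limit (F pUU) E (λ f≈g → f≈g)
    (λ f≈g → ⊕-truncated (≈[]-refl A-UU) (⊝-truncated (⊗-truncated (≈[]-refl (X ⊗ X ⊗ Y ⊗ Y)) f≈g)))
    F≈[]E E-telescopes

  F-UU≈F-DD : F pUU ≈ F pDD
  F-UU≈F-DD = R.trans (F≈GF pUU (occ pUU ∘ word) (λ _ → ≡.refl)) (R.sym (F≈GF pDD (occ pUU ∘ word) occ-DD≡occ-UU))

  F-DD-quadratic : F pDD ⊗ Q (F pDD) ≈ one
  F-DD-quadratic = R.trans (⊗-cong F-DD≈F-UU (⊕-congˡ A-UU (⊝-cong (⊗-congˡ (X ⊗ X ⊗ Y ⊗ Y) F-DD≈F-UU)))) F-quadratic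
    where
    F-DD≈F-UU : F pDD ≈ F pUU
    F-DD≈F-UU = R.sym F-UU≈F-DD

  sqrt : ∀ f → f ⊗ Q f ≈ one → IsSqrtOf (A-UU ⊖ two ⊗ X ⊗ X ⊗ Y ⊗ Y ⊗ f) B-UU
  sqrt f f⊗Qf≈1 = ≡.refl , vanishing-correction B-UU (⊝ (const (+ 4) ⊗ X ⊗ X ⊗ Y ⊗ Y))
    (solve 3 (λ x y f →
      let A = x :* x :* y :* y :- x :* x :* y :- x :+ con (+ 1)
          T = x :* x :* y :* (y :- con (+ 1)) :- x :+ con (+ 1) in
      (A :- con (+ 2) :* x :* x :* y :* y :* f) :* (A :- con (+ 2) :* x :* x :* y :* y :* f)
        := (:- (con (+ 4) :* x :* x :* y :* y) :+ T :* T)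
           :+ (:- (con (+ 4) :* x :* x :* y :* y)) :* (f :* (A :- x :* x :* y :* y :* f) :- con (+ 1)))
      R.refl X Y f)
    f⊗Qf≈1

module PatternDU where
  open import Data.Integer using (+_)
  open Bivariate
  open Telescoping
  open Truncation
  open GeneratingFunctions
  open Occurrences
  open HeightFiltration D U
  private module R = CommutativeRing commutativeRing

  inner-DU≡0 : ∀ α → inner D U α ≡ 0
  inner-DU≡0 ε          = ≡.refl
  inner-DU≡0 (node _ _) = ≡.refl

  -- β contributes a valley DU at its start exactly when it is nonempty.
  Φ : PS → PS
  Φ f = one ⊕ Y ⊗ (f ⊖ one)

  e a : ℕ → PS
  e h = Φ (E h)
  a h = Y ⊗ A h

  A-suc : ∀ h → A (suc h) ≈ X ⊗ (A h ⊗ e (suc h))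
  A-suc h = R.trans (A-first-return h) (⊗-congˡ X (⊗-cong
    (GF-+-zero (heightExactly h) stat (inner D U) inner-DU≡0)
    (R.trans (GF-+-nonempty (heightAtMost (suc h)) stat (outer D U) ≡.refl ≡.refl ≡.refl (λ _ _ → ≡.refl))
             (⊕-congˡ one (R.sym (Y⊗≈shiftᵧ (E (suc h) ⊖ one)))))))

  a-suc : ∀ h → a (suc h) ≈ X ⊗ (a h ⊗ e (suc h))
  a-suc h = R.trans (⊗-congˡ Y (A-suc h))
    (solve 4 (λ x y b r → y :* (x :* (b :* r)) := x :* ((y :* b) :* r)) R.refl X Y (A h) (e (suc h)))

  e-suc : ∀ h → e (suc h) ≈ e h ⊕ a (suc h)
  e-suc h = R.trans (⊕-congˡ one (⊗-congˡ Y (⊕-congʳ (⊝ one) (E-suc h))))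
    (solve 3 (λ y f b → con (+ 1) :+ y :* ((f :+ b) :- con (+ 1)) := (con (+ 1) :+ y :* (f :- con (+ 1))) :+ y :* b)
      R.refl Y (E h) (A (suc h)))

  Q : PS → PS
  Q f = one ⊖ X ⊗ Y ⊖ X ⊗ X ⊗ Y ⊗ f

  e-telescopes : ∀ h → e (2 ℕ.+ h) ⊗ Q (E h) ≈ one
  e-telescopes = telescope e a (Q ∘ E) (X ⊗ Y) X
    (R.trans (e-suc 0) (⊕-congʳ (a 1) (R.trans (⊕-congˡ one (⊗-congˡ Y (⊕-congʳ (⊝ one) E-0)))
      (solve 1 (λ y → con (+ 1) :+ y :* (con (+ 1) :- con (+ 1)) := con (+ 1)) R.refl Y))))
    (R.trans (a-suc 0) (R.trans (⊗-congˡ X (⊗-congʳ (e 1) (⊗-congˡ Y (GF-heightExactly-0 stat ≡.refl))))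
      (solve 3 (λ x y r → x :* ((y :* con (+ 1)) :* r) := (x :* y) :* r) R.refl X Y (e 1))))
    (λ h → e-suc (suc h)) (λ h → a-suc (suc h))
    (R.trans (⊕-congˡ (one ⊖ X ⊗ Y) (⊝-cong (⊗-congˡ (X ⊗ X ⊗ Y) E-0)))
      (solve 2 (λ x y → con (+ 1) :- x :* y :- x :* x :* y :* con (+ 1) := con (+ 1) :- x :* y :- x :* (x :* y)) R.refl X Y))
    (λ h → R.trans (⊕-congˡ (one ⊖ X ⊗ Y) (⊝-cong (⊗-congˡ (X ⊗ X ⊗ Y) (E-suc h))))
      (solve 4 (λ x y f b → con (+ 1) :- x :* y :- x :* x :* y :* (f :+ b)
                            := con (+ 1) :- x :* y :- x :* x :* y :* f :- x :* x :* (y :* b))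
        R.refl X Y (E h) (A (suc h))))

  F-quadratic : Φ (F pDU) ⊗ Q (F pDU) ≈ one
  F-quadratic = ⊗≈one-in-the-limit (F pDU) E
    (λ f≈g → ⊕-truncated (≈[]-refl one) (⊗-truncated (≈[]-refl Y) (⊕-truncated f≈g (≈[]-refl (⊝ one)))))
    (λ f≈g → ⊕-truncated (≈[]-refl (one ⊖ X ⊗ Y)) (⊝-truncated (⊗-truncated (≈[]-refl (X ⊗ X ⊗ Y)) f≈g)))
    F≈[]E e-telescopes

  sqrt : ∀ f → Φ f ⊗ Q f ≈ one → IsSqrtOf (A-DU ⊖ two ⊗ X ⊗ X ⊗ Y ⊗ f) B-UD
  sqrt f Φf⊗Qf≈1 = ≡.refl , vanishing-correction B-UD (⊝ (const (+ 4) ⊗ X ⊗ X))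
    (solve 3 (λ x y f →
      let A = x :* x :* y :- x :* x :- x :* y :+ con (+ 1)
          T = x :* x :* (y :- con (+ 1)) :+ x :* y :- con (+ 1) in
      (A :- con (+ 2) :* x :* x :* y :* f) :* (A :- con (+ 2) :* x :* x :* y :* f)
        := (:- (con (+ 4) :* x :* x) :+ T :* T)
           :+ (:- (con (+ 4) :* x :* x)) :* ((con (+ 1) :+ y :* (f :- con (+ 1))) :* (con (+ 1) :- x :* y :- x :* x :* y :* f)
                                              :- con (+ 1)))
      R.refl X Y f)
    Φf⊗Qf≈1

theorem2 : IsSqrtOf (A-UD ⊖ two ⊗ X ⊗ X ⊗ F pUD) B-UD
    × IsSqrtOf (A-UU ⊖ two ⊗ X ⊗ X ⊗ Y ⊗ Y ⊗ F pUU) B-UU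
    × F pUU ≈ F pDD
    × IsSqrtOf (A-UU ⊖ two ⊗ X ⊗ X ⊗ Y ⊗ Y ⊗ F pDD) B-UU
    × IsSqrtOf (A-DU ⊖ two ⊗ X ⊗ X ⊗ Y ⊗ F pDU) B-UD
theorem2 =
    PatternUD.sqrt (F pUD) PatternUD.F-quadratic
  , PatternUU.sqrt (F pUU) PatternUU.F-quadratic
  , PatternUU.F-UU≈F-DD
  , PatternUU.sqrt (F pDD) PatternUU.F-DD-quadratic
  , PatternDU.sqrt (F pDU) PatternDU.F-quadratic
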